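{- Let $X$ be a finite set of clocks, $\alpha: X\to\mathbb{N}$ a bound function, $R$ a region with respect to $\alpha$, and $Z$ a zone over $X$. Then $R \cap Z = \emptyset$ if and only if there exist $x, y \in X\cup\{x_0\}$ such that $Z_{yx} + R_{xy} \le (<,0)$.
   Context: Clock valuations are maps $X\to\mathbb{R}_{\ge0}$. A zone is a set of valuations defined by a conjunction of constraints $x-y\,\#\,c$ or $x\,\#\,c$ with $c\in\mathbb{N}$, $\#\in\{<,\le,=,\ge,>\}$. Weights are pairs $(\preccurlyeq,c)$, $\preccurlyeq\in\{\le,<\}$, $c\in\mathbb{Z}\cup\{\infty\}$; order $(\preccurlyeq_1,c_1)<(\preccurlyeq_2,c_2)$ iff $c_1<c_2$ or ($c_1=c_2$, $\preccurlyeq_1$ is $<$, $\preccurlyeq_2$ is $\le$); addition $(\preccurlyeq_1,c_1)+(\preccurlyeq_2,c_2)=(\preccurlyeq,c_1+c_2)$ with $\preccurlyeq$ strict iff one summand is strict. A distance graph has vertices $X\cup\{x_0\}$ ($x_0$ a special clock equal to $0$, written $0$ in subscripts) and an edge $x\to y$ with weight $(\preccurlyeq,c)$ representing $y-x\preccurlyeq c$; canonical form means every edge weight equals the least weight of a path between its endpoints. $Z_{xy}$ (resp. $R_{xy}$) is the weight of the edge $x\to y$ in the canonical distance graph representing the zone $Z$ (resp. the constraints defining the region $R$). A region w.r.t. $\alpha$ is specified by: for each clock $x$ one constraint among $x=c$ ($c=0,\dots,\alpha_x$), $c-1<x<c$ ($c=1,\dots,\alpha_x$), $x>\alpha_x$;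 and for each pair of clocks both in open unit intervals, whether the fractional part of the first is less than, equal to, or greater than that of the second.
   Formalization: Clock valuations take values in the non-negative rationals rather than in ℝ≥0. -}

module Defs where

open import Data.Nat as ℕ using (ℕ; zero; suc)
open import Data.Integer as ℤ using (ℤ; +_)
open import Data.Rational as ℚ using (ℚ; 0ℚ; fracPart)
open import Data.Fin as Fin using (Fin; zero; suc)
open import Data.Product using (_×_; Σ)
open import Data.Sum using (_⊎_)
open import Data.Unit using (⊤)
open import Relation.Binary.PropositionalEquality using (_≡_; _≢_)
open import Relation.Nullary using (yes; no)

data Strictness : Set where
  strict weak : Strictness

data Weight : Set where
  fin : Strictness → ℤ → Weight
  ∞   : Weight

_⊕s_ : Strictness → Strictness → Strictness
weak ⊕s weak = weak
_    ⊕s _    = strict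

infixl 6 _⊕_
_⊕_ : Weight → Weight → Weight
fin s c ⊕ fin s' c' = fin (s ⊕s s') (c ℤ.+ c')
fin _ _ ⊕ ∞         = ∞
∞       ⊕ _         = ∞

infix 4 _<w_ _≤w_
data _<w_ : Weight → Weight → Set where
  <-val : ∀ {s s' c c'} → c ℤ.< c' → fin s c <w fin s' c'
  <-str : ∀ {c} → fin strict c <w fin weak c
  <-∞   : ∀ {s c} → fin s c <w ∞

_≤w_ : Weight → Weight → Set
w ≤w w' = (w <w w') ⊎ (w ≡ w')

_⊓w_ : Weight → Weight → Weight
∞ ⊓w w = w
w ⊓w ∞ = w
fin s c ⊓w fin s' c' with c ℤ.<? c' | c' ℤ.<? c
... | yes _ | _     = fin s c
... | no _  | yes _ = fin s' c'
... | no _  | no _  = fin (s ⊕s s') c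

-- Distance graphs over clocks X = Fin n; vertices Fin (suc n), zero = x₀.
-- An edge x → y with weight (≼ , c) represents  y - x ≼ c.

Vertex : ℕ → Set
Vertex n = Fin (suc n)

Graph : ℕ → Set
Graph n = Vertex n → Vertex n → Weight

-- walks (paths, possibly with repeated vertices, possibly empty)
-- a step from x goes along the edge x → y and then continues from y
data Walk {n : ℕ} : Vertex n → Vertex n → Set where
  []  : ∀ {x} → Walk x x
  _∷_ : ∀ {x} y {z} → Walk y z → Walk x z

walkWeight : ∀ {n} (G : Graph n) {x y : Vertex n} → Walk x y → Weight
walkWeight G         []               = fin weak (+ 0)
walkWeight G {x = x} (_∷_ y p) = G x y ⊕ walkWeight G p

IsCanonicalFormOf : ∀ {n} → Graph n → Graph n → Set
IsCanonicalFormOf {n} G C =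
  (x y : Vertex n) →
    ((p : Walk x y) → C x y ≤w walkWeight G p)
    × ((w : Weight) → ((p : Walk x y) → w ≤w walkWeight G p) → w ≤w C x y)

Valuation : ℕ → Set
Valuation n = Fin n → ℚ

IsValuation : ∀ {n} → Valuation n → Set
IsValuation {n} v = (x : Fin n) → 0ℚ ℚ.≤ v x

ext : ∀ {n} → Valuation n → Vertex n → ℚ
ext v zero    = 0ℚ
ext v (suc x) = v x

ℤtoℚ : ℤ → ℚ
ℤtoℚ c = c ℚ./ 1

SatW : ℚ → Weight → Set
SatW q (fin weak c)   = q ℚ.≤ ℤtoℚ c
SatW q (fin strict c) = q ℚ.< ℤtoℚ c
SatW q ∞              = ⊤

_∈G_ : ∀ {n} → Valuation n → Graph n → Set
_∈G_ {n} v G = IsValuation v ×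
  ((x y : Vertex n) → SatW (ext v y ℚ.- ext v x) (G x y))

data Interval (b : ℕ) : Set where
  equal  : (c : ℕ) → c ℕ.≤ b → Interval b
  open'  : (c : ℕ) → 1 ℕ.≤ c → c ℕ.≤ b → Interval b       -- c - 1 < x < c
  above  : Interval b

data FracCmp : Set where
  lt eq gt : FracCmp

record Region {n : ℕ} (α : Fin n → ℕ) : Set where
  field
    interval : (x : Fin n) → Interval (α x)
    -- fractional part comparison of x with y (only relevant when both
    -- x and y lie in open unit intervals and x ≢ y)
    frac     : Fin n → Fin n → FracCmp

open Region public

InInterval : ∀ {b} → ℚ → Interval b → Set
InInterval q (equal c _)   = q ≡ ℤtoℚ (+ c)
InInterval q (open' c _ _) = (ℤtoℚ (+ c) ℚ.- ℤtoℚ (+ 1) ℚ.< q) × (q ℚ.< ℤtoℚ (+ c))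
InInterval {b} q above     = ℤtoℚ (+ b) ℚ.< q

IsOpen : ∀ {b} → Interval b → Set
IsOpen (open' _ _ _) = ⊤
IsOpen _             = Data.Empty.⊥
  where import Data.Empty

SatFrac : ℚ → ℚ → FracCmp → Set
SatFrac p q lt = fracPart p ℚ.< fracPart q
SatFrac p q eq = fracPart p ≡ fracPart q
SatFrac p q gt = fracPart q ℚ.< fracPart p

_∈R_ : ∀ {n} {α : Fin n → ℕ} → Valuation n → Region α → Set
_∈R_ {n} v R = IsValuation v
  × ((x : Fin n) → InInterval (v x) (interval R x))
  × ((x y : Fin n) → x ≢ y → IsOpen (interval R x) → IsOpen (interval R y)
       → SatFrac (v x) (v y) (frac R x y))

-- The distance graph of the constraints defining a region.
-- x = c              :  x - 0 ≤ c ,  0 - x ≤ -c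
-- c - 1 < x < c      :  x - 0 < c ,  0 - x < -(c-1)
-- x > b              :  0 - x < -b
-- frac x < frac y (x ∈ (c-1,c), y ∈ (d-1,d)) :  x - y < c - d
-- frac x = frac y    :  x - y ≤ c - d , y - x ≤ d - c
-- frac x > frac y    :  y - x < d - c

upper : ∀ {b} → Interval b → Weight
upper (equal c _)   = fin weak (+ c)
upper (open' c _ _) = fin strict (+ c)
upper above         = ∞

lower : ∀ {b} → Interval b → Weight
lower (equal c _)      = fin weak (ℤ.- (+ c))
lower (open' c _ _)    = fin strict (ℤ.- (+ (c ℕ.∸ 1)))
lower {b} above        = fin strict (ℤ.- (+ b))

-- constraint on y - x coming from the comparison 'frac x ? frac y'
-- (x ∈ (c-1,c), y ∈ (d-1,d))
fracEdgeXY : ℕ → ℕ → FracCmp → Weight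
fracEdgeXY c d lt = ∞
fracEdgeXY c d eq = fin weak (+ d ℤ.- + c)
fracEdgeXY c d gt = fin strict (+ d ℤ.- + c)

fracEdgeYX : ℕ → ℕ → FracCmp → Weight
fracEdgeYX c d lt = fin strict (+ c ℤ.- + d)
fracEdgeYX c d eq = fin weak (+ c ℤ.- + d)
fracEdgeYX c d gt = ∞

fromXY : ∀ {b b'} → Interval b → Interval b' → FracCmp → Weight
fromXY (open' c _ _) (open' d _ _) k = fracEdgeXY c d k
fromXY _ _ _ = ∞

fromYX : ∀ {b b'} → Interval b → Interval b' → FracCmp → Weight
fromYX (open' c _ _) (open' d _ _) k = fracEdgeYX c d k
fromYX _ _ _ = ∞

regionGraph : ∀ {n} {α : Fin n → ℕ} → Region α → Graph n
regionGraph R zero    zero    = ∞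
regionGraph R zero    (suc x) = upper (interval R x)
regionGraph R (suc x) zero    = lower (interval R x)
regionGraph R (suc x) (suc y) with x Fin.≟ y
... | yes _ = ∞
... | no _  =
  fromXY (interval R x) (interval R y) (frac R x y)
    ⊓w fromYX (interval R y) (interval R x) (frac R y x)

-- If v lies in R ∩ Z, then rounding v x - v y up to a weight gives a lower bound for every
-- walk from y to x in the graph of Z, hence for Zc y x, and symmetrically for Rc x y; the two
-- roundings sum to a nonnegative weight, so no two-cycle Zc y x ⊕ Rc x y can be negative.
--
-- Conversely, suppose every such two-cycle is nonnegative. Then so is every cycle of the
-- region graph, so the fractional-part comparisons recorded by R form a strict weak order,
-- and R has a canonical point: each bounded clock takes its integral part from its interval
-- and the fractional part (r + 1)/(n + 2), r its rank in that order. Every bound of Rc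
-- between bounded clocks is attained at this point up to rounding, so nonnegativity of the
-- two-cycles makes the point satisfy Zc as well. The clocks above their bound are then added
-- one at a time, each time picking a value between the tightest lower and upper bound that
-- Zc, strengthened by the lower bounds x > α x, imposes; the triangle inequality of the
-- canonical Zc keeps these bounds compatible.

module Submission where

open import Defs
open import Data.Nat as ℕ using (ℕ; zero; suc)
import Data.Nat.Properties as ℕP
import Data.Nat.GCD as ℕGCD
import Data.Nat.Coprimality as ℕC
open import Data.Integer as ℤ using (ℤ; +_)
import Data.Integer.Properties as ℤP
import Data.Integer.DivMod as ℤD
import Data.Integer.GCD as ℤGCD
open import Data.Integer.Tactic.RingSolver using (solve-∀)
open import Data.Rational as ℚ using (ℚ; mkℚ; 0ℚ; 1ℚ; ↥_; ↧_)
import Data.Rational.Properties as ℚP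
open import Data.Rational.Solver using (module +-*-Solver)
open import Data.Fin as Fin using (Fin; zero; suc)
import Data.Fin.Properties as FinP
open import Data.List using (List; []; _∷_; allFin)
open import Data.List.Relation.Unary.Any using (here; there; any?)
open import Data.List.Membership.Propositional using (_∈_)
open import Data.List.Membership.Propositional.Properties using (∈-allFin)
open import Data.Maybe using (Maybe; just; nothing)
open import Data.Vec.Functional using (updateAt)
open import Data.Vec.Functional.Properties using (updateAt-updates; updateAt-minimal)
open import Data.Bool using (true; false; T)
open import Data.Product using (_×_; _,_; Σ; ∃₂; proj₁; proj₂)
open import Data.Sum using (_⊎_; inj₁; inj₂)
open import Data.Empty using (⊥; ⊥-elim)
open import Data.Unit using (⊤; tt)
open import Relation.Binary.PropositionalEquality
open import Relation.Binary.Definitions using (tri<; tri≈; tri>)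
open import Relation.Nullary using (¬_; Dec; yes; no)
import Relation.Nullary.Decidable as Dec
open import Function.Base using (_∘_)
open import Function.Bundles using (_⇔_; mk⇔)

module QS = +-*-Solver

0w : Weight
0w = fin weak (+ 0)

⊕s-comm : ∀ s t → s ⊕s t ≡ t ⊕s s
⊕s-comm weak   weak   = refl
⊕s-comm weak   strict = refl
⊕s-comm strict weak   = refl
⊕s-comm strict strict = refl

⊕s-assoc : ∀ s t u → (s ⊕s t) ⊕s u ≡ s ⊕s (t ⊕s u)
⊕s-assoc weak   weak   weak   = refl
⊕s-assoc weak   weak   strict = refl
⊕s-assoc weak   strict _      = refl
⊕s-assoc strict _      _      = refl

⊕-comm : ∀ a b → a ⊕ b ≡ b ⊕ a
⊕-comm (fin s c) (fin t d) = cong₂ fin (⊕s-comm s t) (ℤP.+-comm c d)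
⊕-comm (fin _ _) ∞         = refl
⊕-comm ∞         (fin _ _) = refl
⊕-comm ∞         ∞         = refl

⊕-assoc : ∀ a b c → (a ⊕ b) ⊕ c ≡ a ⊕ (b ⊕ c)
⊕-assoc (fin s x) (fin t y) (fin u z) = cong₂ fin (⊕s-assoc s t u) (ℤP.+-assoc x y z)
⊕-assoc (fin _ _) (fin _ _) ∞         = refl
⊕-assoc (fin _ _) ∞         _         = refl
⊕-assoc ∞         _         _         = refl

⊕-identityˡ : ∀ a → 0w ⊕ a ≡ a
⊕-identityˡ (fin weak c)   = cong (fin weak) (ℤP.+-identityˡ c)
⊕-identityˡ (fin strict c) = cong (fin strict) (ℤP.+-identityˡ c)
⊕-identityˡ ∞              = refl

⊕-identityʳ : ∀ a → a ⊕ 0w ≡ a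
⊕-identityʳ a = trans (⊕-comm a 0w) (⊕-identityˡ a)

⊕-zeroʳ : ∀ a → a ⊕ ∞ ≡ ∞
⊕-zeroʳ (fin _ _) = refl
⊕-zeroʳ ∞         = refl

<w-irrefl : ∀ {a} → ¬ (a <w a)
<w-irrefl (<-val p) = ℤP.<-irrefl refl p

<w-trans : ∀ {a b c} → a <w b → b <w c → a <w c
<w-trans (<-val p) (<-val q) = <-val (ℤP.<-trans p q)
<w-trans (<-val p) <-str     = <-val p
<w-trans (<-val _) <-∞       = <-∞
<w-trans <-str     (<-val q) = <-val q
<w-trans <-str     <-∞       = <-∞

<w-≤w-trans : ∀ {a b c} → a <w b → b ≤w c → a <w c
<w-≤w-trans p (inj₁ q)    = <w-trans p q
<w-≤w-trans p (inj₂ refl) = p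

≤w-<w-trans : ∀ {a b c} → a ≤w b → b <w c → a <w c
≤w-<w-trans (inj₁ p)    q = <w-trans p q
≤w-<w-trans (inj₂ refl) q = q

≤w-trans : ∀ {a b c} → a ≤w b → b ≤w c → a ≤w c
≤w-trans (inj₁ p)    q = inj₁ (<w-≤w-trans p q)
≤w-trans (inj₂ refl) q = q

≤w-refl : ∀ {a} → a ≤w a
≤w-refl = inj₂ refl

≤w-reflexive : ∀ {a b} → a ≡ b → a ≤w b
≤w-reflexive = inj₂

≤w-∞ : ∀ {w} → w ≤w ∞
≤w-∞ {fin _ _} = inj₁ <-∞
≤w-∞ {∞}       = inj₂ refl

∞-≤w : ∀ {w} → ∞ ≤w w → w ≡ ∞
∞-≤w (inj₂ refl) = refl

<w-cmp : ∀ a b → (a <w b) ⊎ (a ≡ b) ⊎ (b <w a)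
<w-cmp (fin s c) (fin t d) with ℤP.<-cmp c d
... | tri< c<d _ _ = inj₁ (<-val c<d)
... | tri> _ _ d<c = inj₂ (inj₂ (<-val d<c))
<w-cmp (fin weak c)   (fin weak .c)   | tri≈ _ refl _ = inj₂ (inj₁ refl)
<w-cmp (fin weak c)   (fin strict .c) | tri≈ _ refl _ = inj₂ (inj₂ <-str)
<w-cmp (fin strict c) (fin weak .c)   | tri≈ _ refl _ = inj₁ <-str
<w-cmp (fin strict c) (fin strict .c) | tri≈ _ refl _ = inj₂ (inj₁ refl)
<w-cmp (fin _ _) ∞         = inj₁ <-∞
<w-cmp ∞         (fin _ _) = inj₂ (inj₂ <-∞)
<w-cmp ∞         ∞         = inj₂ (inj₁ refl)

infix 4 _≤w?_
_≤w?_ : ∀ a b → Dec (a ≤w b)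
a ≤w? b with <w-cmp a b
... | inj₁ a<b        = yes (inj₁ a<b)
... | inj₂ (inj₁ a≡b) = yes (inj₂ a≡b)
... | inj₂ (inj₂ b<a) = no (λ a≤b → <w-irrefl (<w-≤w-trans b<a a≤b))

≰w⇒>w : ∀ {a b} → ¬ (a ≤w b) → b <w a
≰w⇒>w {a} {b} a≰b with <w-cmp a b
... | inj₁ a<b        = ⊥-elim (a≰b (inj₁ a<b))
... | inj₂ (inj₁ a≡b) = ⊥-elim (a≰b (inj₂ a≡b))
... | inj₂ (inj₂ b<a) = b<a

⊕-monoˡ-<w⇒≤w : ∀ {a b} c → a <w b → a ⊕ c ≤w b ⊕ c
⊕-monoˡ-<w⇒≤w (fin _ d)      (<-val p) = inj₁ (<-val (ℤP.+-monoˡ-< d p))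
⊕-monoˡ-<w⇒≤w (fin weak _)   <-str     = inj₁ <-str
⊕-monoˡ-<w⇒≤w (fin strict _) <-str     = inj₂ refl
⊕-monoˡ-<w⇒≤w (fin _ _)      <-∞       = inj₁ <-∞
⊕-monoˡ-<w⇒≤w ∞              (<-val _) = inj₂ refl
⊕-monoˡ-<w⇒≤w ∞              <-str     = inj₂ refl
⊕-monoˡ-<w⇒≤w ∞              <-∞       = inj₂ refl

⊕-monoˡ-≤w : ∀ {a b} c → a ≤w b → a ⊕ c ≤w b ⊕ c
⊕-monoˡ-≤w c (inj₁ a<b)  = ⊕-monoˡ-<w⇒≤w c a<b
⊕-monoˡ-≤w c (inj₂ refl) = inj₂ refl

⊕-monoʳ-≤w : ∀ {a b} c → a ≤w b → c ⊕ a ≤w c ⊕ b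
⊕-monoʳ-≤w {a} {b} c a≤b rewrite ⊕-comm c a | ⊕-comm c b = ⊕-monoˡ-≤w c a≤b

⊕-mono-≤w : ∀ {a b c d} → a ≤w b → c ≤w d → a ⊕ c ≤w b ⊕ d
⊕-mono-≤w {b = b} {c = c} a≤b c≤d = ≤w-trans (⊕-monoˡ-≤w c a≤b) (⊕-monoʳ-≤w b c≤d)

⊓w-sel : ∀ a b → (a ⊓w b ≡ a) ⊎ (a ⊓w b ≡ b)
⊓w-sel ∞ b = inj₂ refl
⊓w-sel (fin s c) ∞ = inj₁ refl
⊓w-sel (fin s c) (fin s′ c′) with c ℤ.<? c′ | c′ ℤ.<? c
... | yes _ | _     = inj₁ refl
... | no _  | yes _ = inj₂ refl
... | no c≮c′ | no c′≮c with ℤP.≤-antisym (ℤP.≮⇒≥ c′≮c) (ℤP.≮⇒≥ c≮c′)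
⊓w-sel (fin weak c)   (fin weak .c)   | no _ | no _ | refl = inj₁ refl
⊓w-sel (fin weak c)   (fin strict .c) | no _ | no _ | refl = inj₂ refl
⊓w-sel (fin strict c) (fin _ .c)      | no _ | no _ | refl = inj₁ refl

⊓w-≤ˡ : ∀ a b → a ⊓w b ≤w a
⊓w-≤ˡ ∞ b = ≤w-∞
⊓w-≤ˡ (fin s c) ∞ = inj₂ refl
⊓w-≤ˡ (fin s c) (fin s′ c′) with c ℤ.<? c′ | c′ ℤ.<? c
... | yes _ | _        = inj₂ refl
... | no _  | yes c′<c = inj₁ (<-val c′<c)
... | no c≮c′ | no c′≮c with ℤP.≤-antisym (ℤP.≮⇒≥ c′≮c) (ℤP.≮⇒≥ c≮c′)
⊓w-≤ˡ (fin weak c)   (fin weak .c)   | no _ | no _ | refl = inj₂ refl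
⊓w-≤ˡ (fin weak c)   (fin strict .c) | no _ | no _ | refl = inj₁ <-str
⊓w-≤ˡ (fin strict c) (fin _ .c)      | no _ | no _ | refl = inj₂ refl

⊓w-≤ʳ : ∀ a b → a ⊓w b ≤w b
⊓w-≤ʳ ∞ b = inj₂ refl
⊓w-≤ʳ (fin s c) ∞ = inj₁ <-∞
⊓w-≤ʳ (fin s c) (fin s′ c′) with c ℤ.<? c′ | c′ ℤ.<? c
... | yes c<c′ | _     = inj₁ (<-val c<c′)
... | no _     | yes _ = inj₂ refl
... | no c≮c′ | no c′≮c with ℤP.≤-antisym (ℤP.≮⇒≥ c′≮c) (ℤP.≮⇒≥ c≮c′)
⊓w-≤ʳ (fin weak c)   (fin weak .c)   | no _ | no _ | refl = inj₂ refl
⊓w-≤ʳ (fin weak c)   (fin strict .c) | no _ | no _ | refl = inj₂ refl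
⊓w-≤ʳ (fin strict c) (fin weak .c)   | no _ | no _ | refl = inj₁ <-str
⊓w-≤ʳ (fin strict c) (fin strict .c) | no _ | no _ | refl = inj₂ refl

minOver : ∀ {m} → (Fin m → Weight) → Weight
minOver {zero}  f = ∞
minOver {suc m} f = f zero ⊓w minOver (f ∘ suc)

minOver-≤ : ∀ {m} (f : Fin m → Weight) u → minOver f ≤w f u
minOver-≤ {suc m} f zero    = ⊓w-≤ˡ (f zero) _
minOver-≤ {suc m} f (suc u) = ≤w-trans (⊓w-≤ʳ (f zero) _) (minOver-≤ (f ∘ suc) u)

minOver-attained : ∀ {m} (f : Fin m → Weight) → minOver f ≡ ∞ ⊎ Σ (Fin m) (λ u → minOver f ≡ f u)
minOver-attained {zero}  f = inj₁ refl
minOver-attained {suc m} f with ⊓w-sel (f zero) (minOver (f ∘ suc))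
... | inj₁ e = inj₂ (zero , e)
... | inj₂ e with minOver-attained (f ∘ suc)
...   | inj₁ e′       = inj₁ (trans e e′)
...   | inj₂ (u , e′) = inj₂ (suc u , trans e e′)

i+j-i≡j : ∀ (i j : ℤ) → (i ℤ.+ j) ℤ.- i ≡ j
i+j-i≡j = solve-∀

i+[j-i]≡j : ∀ (i j : ℤ) → i ℤ.+ (j ℤ.- i) ≡ j
i+[j-i]≡j = solve-∀

i+j-j≡i : ∀ (i j : ℤ) → i ℤ.+ j ℤ.- j ≡ i
i+j-j≡i = solve-∀

i-1+1≡i : ∀ (i : ℤ) → i ℤ.- + 1 ℤ.+ + 1 ≡ i
i-1+1≡i = solve-∀

i+1-1≡i : ∀ (i : ℤ) → i ℤ.+ + 1 ℤ.- + 1 ≡ i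
i+1-1≡i = solve-∀

[j-1]-[i-1]≡j-i : ∀ (i j : ℤ) → (j ℤ.- + 1) ℤ.- (i ℤ.- + 1) ≡ j ℤ.- i
[j-1]-[i-1]≡j-i = solve-∀

≤+⇒-≤ : ∀ {a b k : ℤ} → a ℤ.≤ b ℤ.+ k → a ℤ.- b ℤ.≤ k
≤+⇒-≤ {a} {b} {k} p = subst (a ℤ.- b ℤ.≤_) (i+j-i≡j b k) (ℤP.+-monoˡ-≤ (ℤ.- b) p)

-≤⇒≤+ : ∀ {a b k : ℤ} → a ℤ.- b ℤ.≤ k → a ℤ.≤ b ℤ.+ k
-≤⇒≤+ {a} {b} {k} p = subst (ℤ._≤ b ℤ.+ k) (i+[j-i]≡j b a) (ℤP.+-monoʳ-≤ b p)

<+⇒-< : ∀ {a b k : ℤ} → a ℤ.< b ℤ.+ k → a ℤ.- b ℤ.< k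
<+⇒-< {a} {b} {k} p = subst (a ℤ.- b ℤ.<_) (i+j-i≡j b k) (ℤP.+-monoˡ-< (ℤ.- b) p)

-<⇒<+ : ∀ {a b k : ℤ} → a ℤ.- b ℤ.< k → a ℤ.< b ℤ.+ k
-<⇒<+ {a} {b} {k} p = subst (ℤ._< b ℤ.+ k) (i+[j-i]≡j b a) (ℤP.+-monoʳ-< b p)

<⇒+1≤ : ∀ {a b : ℤ} → a ℤ.< b → a ℤ.+ + 1 ℤ.≤ b
<⇒+1≤ {a} p = subst (ℤ._≤ _) (ℤP.+-comm (+ 1) a) (ℤP.i<j⇒suc[i]≤j p)

+1≤⇒< : ∀ {a b : ℤ} → a ℤ.+ + 1 ℤ.≤ b → a ℤ.< b
+1≤⇒< {a} p = ℤP.suc[i]≤j⇒i<j (subst (ℤ._≤ _) (ℤP.+-comm a (+ 1)) p)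

<+1⇒≤ : ∀ {a b : ℤ} → a ℤ.< b ℤ.+ + 1 → a ℤ.≤ b
<+1⇒≤ {a} {b} p = subst (a ℤ.≤_) (ℤP.pred-suc b)
  (ℤP.i<j⇒i≤pred[j] (subst (a ℤ.<_) (ℤP.+-comm b (+ 1)) p))

-1<⇒≤ : ∀ {k c : ℤ} → k ℤ.- + 1 ℤ.< c → k ℤ.≤ c
-1<⇒≤ {k} {c} p = subst (ℤ._≤ c) (i-1+1≡i k) (<⇒+1≤ p)

0≤a+b⇒-b≤a : ∀ {a b : ℤ} → + 0 ℤ.≤ a ℤ.+ b → ℤ.- b ℤ.≤ a
0≤a+b⇒-b≤a {a} {b} h =
  subst₂ ℤ._≤_ (ℤP.+-identityˡ (ℤ.- b)) (i+j-j≡i a b) (ℤP.+-monoˡ-≤ (ℤ.- b) h)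

0<a+b⇒-b<a : ∀ {a b : ℤ} → + 0 ℤ.< a ℤ.+ b → ℤ.- b ℤ.< a
0<a+b⇒-b<a {a} {b} h =
  subst₂ ℤ._<_ (ℤP.+-identityˡ (ℤ.- b)) (i+j-j≡i a b) (ℤP.+-monoˡ-< (ℤ.- b) h)

0<a+b⇒-[b-1]≤a : ∀ {a b : ℤ} → + 0 ℤ.< a ℤ.+ b → ℤ.- (b ℤ.- + 1) ℤ.≤ a
0<a+b⇒-[b-1]≤a {a} {b} h =
  subst₂ ℤ._≤_ (1-b b) (i+j-j≡i a b) (ℤP.+-monoˡ-≤ (ℤ.- b) (<⇒+1≤ h))
  where
  1-b : ∀ (b : ℤ) → + 0 ℤ.+ + 1 ℤ.- b ≡ ℤ.- (b ℤ.- + 1)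
  1-b = solve-∀

≤⇒<⊎≡ : ∀ {a b : ℤ} → a ℤ.≤ b → (a ℤ.< b) ⊎ (a ≡ b)
≤⇒<⊎≡ {a} {b} p with ℤP.<-cmp a b
... | tri< a<b _ _ = inj₁ a<b
... | tri≈ _ a≡b _ = inj₂ a≡b
... | tri> _ _ b<a = ⊥-elim (ℤP.<-irrefl refl (ℤP.<-≤-trans b<a p))

data FinLeq : Strictness → ℤ → Strictness → ℤ → Set where
  <-fin    : ∀ {s t c d} → c ℤ.< d → FinLeq s c t d
  strict-≤ : ∀ {t c d} → c ℤ.≤ d → FinLeq strict c t d
  weak-≤   : ∀ {c d} → c ℤ.≤ d → FinLeq weak c weak d

≤w⇒FinLeq : ∀ {s t c d} → fin s c ≤w fin t d → FinLeq s c t d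
≤w⇒FinLeq (inj₁ (<-val c<d))   = <-fin c<d
≤w⇒FinLeq (inj₁ <-str)         = strict-≤ ℤP.≤-refl
≤w⇒FinLeq {strict} (inj₂ refl) = strict-≤ ℤP.≤-refl
≤w⇒FinLeq {weak}   (inj₂ refl) = weak-≤ ℤP.≤-refl

FinLeq⇒≤w : ∀ {s t c d} → FinLeq s c t d → fin s c ≤w fin t d
FinLeq⇒≤w (<-fin c<d) = inj₁ (<-val c<d)
FinLeq⇒≤w {t = t} (strict-≤ c≤d) with ≤⇒<⊎≡ c≤d
... | inj₁ c<d = inj₁ (<-val c<d)
FinLeq⇒≤w {t = weak}   (strict-≤ _) | inj₂ refl = inj₁ <-str
FinLeq⇒≤w {t = strict} (strict-≤ _) | inj₂ refl = inj₂ refl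
FinLeq⇒≤w (weak-≤ c≤d) with ≤⇒<⊎≡ c≤d
... | inj₁ c<d  = inj₁ (<-val c<d)
... | inj₂ refl = inj₂ refl

FinLeq⇒≤ : ∀ {s t c d} → FinLeq s c t d → c ℤ.≤ d
FinLeq⇒≤ (<-fin c<d)    = ℤP.<⇒≤ c<d
FinLeq⇒≤ (strict-≤ c≤d) = c≤d
FinLeq⇒≤ (weak-≤ c≤d)   = c≤d

FinLeq-shift : ∀ {s t a b k} → FinLeq s a t (b ℤ.+ k) → FinLeq s (a ℤ.- b) t k
FinLeq-shift (<-fin p)    = <-fin (<+⇒-< p)
FinLeq-shift (strict-≤ p) = strict-≤ (≤+⇒-≤ p)
FinLeq-shift (weak-≤ p)   = weak-≤ (≤+⇒-≤ p)

FinLeq-unshift : ∀ {s t a b k} → FinLeq s (a ℤ.- b) t k → FinLeq s a t (b ℤ.+ k)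
FinLeq-unshift (<-fin p)    = <-fin (-<⇒<+ p)
FinLeq-unshift (strict-≤ p) = strict-≤ (-≤⇒≤+ p)
FinLeq-unshift (weak-≤ p)   = weak-≤ (-≤⇒≤+ p)

0≤w-fin-strict⇒0< : ∀ s {c k} → 0w ≤w fin s c ⊕ fin strict k → + 0 ℤ.< c ℤ.+ k
0≤w-fin-strict⇒0< weak   h with ≤w⇒FinLeq h
... | <-fin p = p
0≤w-fin-strict⇒0< strict h with ≤w⇒FinLeq h
... | <-fin p = p

nonnegative⇒¬negative : ∀ {w} → 0w ≤w w → ¬ (w ≤w fin strict (+ 0))
nonnegative⇒¬negative 0≤w w<0 = <w-irrefl (≤w-<w-trans (≤w-trans 0≤w w<0) <-str)

¬negative⇒nonnegative : ∀ {w} → ¬ (w ≤w fin strict (+ 0)) → 0w ≤w w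
¬negative⇒nonnegative w≮0 with ≰w⇒>w w≮0
... | <-val 0<c = FinLeq⇒≤w (<-fin 0<c)
... | <-str     = ≤w-refl
... | <-∞       = ≤w-∞

-- a ⊖ b is the least t with a ≤w b ⊕ t

_⊖_ : Strictness × ℤ → Strictness × ℤ → Weight
(s′ , c′) ⊖ (weak , c)        = fin s′ (c′ ℤ.- c)
(strict , c′) ⊖ (strict , c) = fin strict (c′ ℤ.- c)
(weak , c′) ⊖ (strict , c)   = fin strict ((c′ ℤ.- c) ℤ.+ + 1)

≤⊕⇒⊖≤ : ∀ s′ c′ s c t → fin s′ c′ ≤w fin s c ⊕ t → (s′ , c′) ⊖ (s , c) ≤w t
≤⊕⇒⊖≤ _      _  weak   _ ∞ _ = ≤w-∞
≤⊕⇒⊖≤ _      _  strict _ ∞ _ = ≤w-∞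
≤⊕⇒⊖≤ _      _  weak   _ (fin weak _)   h = FinLeq⇒≤w (FinLeq-shift (≤w⇒FinLeq h))
≤⊕⇒⊖≤ _      _  weak   _ (fin strict _) h = FinLeq⇒≤w (FinLeq-shift (≤w⇒FinLeq h))
≤⊕⇒⊖≤ strict _  strict _ (fin _ _)      h =
  FinLeq⇒≤w (strict-≤ (FinLeq⇒≤ (FinLeq-shift (≤w⇒FinLeq h))))
≤⊕⇒⊖≤ weak   _  strict _ (fin _ _)      h with ≤w⇒FinLeq h
... | <-fin p = FinLeq⇒≤w (strict-≤ (<⇒+1≤ (<+⇒-< p)))

⊖≤⇒≤⊕ : ∀ s′ c′ s c t → (s′ , c′) ⊖ (s , c) ≤w t → fin s′ c′ ≤w fin s c ⊕ t
⊖≤⇒≤⊕ _      _ weak   _ ∞ _ = inj₁ <-∞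
⊖≤⇒≤⊕ _      _ strict _ ∞ _ = inj₁ <-∞
⊖≤⇒≤⊕ _      _ weak   _ (fin weak _)   h = FinLeq⇒≤w (FinLeq-unshift (≤w⇒FinLeq h))
⊖≤⇒≤⊕ _      _ weak   _ (fin strict _) h = FinLeq⇒≤w (FinLeq-unshift (≤w⇒FinLeq h))
⊖≤⇒≤⊕ strict _ strict _ (fin _ _)      h =
  FinLeq⇒≤w (strict-≤ (FinLeq⇒≤ (FinLeq-unshift (≤w⇒FinLeq h))))
⊖≤⇒≤⊕ weak   _ strict _ (fin _ _)      h =
  FinLeq⇒≤w (<-fin (-<⇒<+ (+1≤⇒< (FinLeq⇒≤ (≤w⇒FinLeq h)))))

≤⊕-glb : ∀ {A : Set} (f : A → Weight) (g : Weight)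
  → (∀ w → (∀ p → w ≤w f p) → w ≤w g)
  → ∀ a b → (∀ p → a ≤w b ⊕ f p) → a ≤w b ⊕ g
≤⊕-glb f g glb a ∞ _ = ≤w-∞
≤⊕-glb f g glb ∞ (fin s c) h with ∞-≤w (glb ∞ λ p → ∞≤⊕ (f p) (h p))
  where
  ∞≤⊕ : ∀ t → ∞ ≤w fin s c ⊕ t → ∞ ≤w t
  ∞≤⊕ ∞         _ = inj₂ refl
  ∞≤⊕ (fin _ _) (inj₂ ())
... | refl = inj₂ refl
≤⊕-glb f g glb (fin s′ c′) (fin s c) h =
  ⊖≤⇒≤⊕ s′ c′ s c g (glb _ (λ p → ≤⊕⇒⊖≤ s′ c′ s c (f p) (h p)))

-- Walks and canonical forms

_++w_ : ∀ {n} {x y z : Vertex n} → Walk x y → Walk y z → Walk x z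
[]      ++w q = q
(y ∷ p) ++w q = y ∷ (p ++w q)

walkWeight-++w : ∀ {n} (G : Graph n) {x y z : Vertex n} (p : Walk x y) (q : Walk y z)
  → walkWeight G (p ++w q) ≡ walkWeight G p ⊕ walkWeight G q
walkWeight-++w G []                q = sym (⊕-identityˡ _)
walkWeight-++w G {x = x} (y ∷ p) q =
  trans (cong (G x y ⊕_) (walkWeight-++w G p q)) (sym (⊕-assoc (G x y) _ _))

module Canonical {n : ℕ} {G C : Graph n} (canonical : IsCanonicalFormOf G C) where

  ≤-walk : ∀ x y (p : Walk x y) → C x y ≤w walkWeight G p
  ≤-walk x y = proj₁ (canonical x y)

  glb : ∀ x y w → ((p : Walk x y) → w ≤w walkWeight G p) → w ≤w C x y
  glb x y = proj₂ (canonical x y)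

  ≤-edge : ∀ x y → C x y ≤w G x y
  ≤-edge x y = subst (C x y ≤w_) (⊕-identityʳ (G x y)) (≤-walk x y (y ∷ []))

  diagonal≤0 : ∀ x → C x x ≤w 0w
  diagonal≤0 x = ≤-walk x x []

  -- C x y is only known as the greatest lower bound of the walk weights, hence the residuation.
  triangle : ∀ x y z → C x z ≤w C x y ⊕ C y z
  triangle x y z = subst (C x z ≤w_) (⊕-comm (C y z) (C x y))
    (≤⊕-glb (walkWeight G) (C x y) (glb x y) (C x z) (C y z)
      (λ p → subst (C x z ≤w_) (⊕-comm (walkWeight G p) (C y z)) (≤p⊕C p)))
    where
    ≤p⊕C : (p : Walk x y) → C x z ≤w walkWeight G p ⊕ C y z
    ≤p⊕C p = ≤⊕-glb (walkWeight G) (C y z) (glb y z) (C x z) (walkWeight G p)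
      (λ q → subst (C x z ≤w_) (walkWeight-++w G p q) (≤-walk x z (p ++w q)))

↥↧-injective : ∀ (p q : ℚ) → ↥ p ≡ ↥ q → ↧ p ≡ ↧ q → p ≡ q
↥↧-injective (mkℚ _ _ _) (mkℚ _ _ _) refl refl = refl

gcd[k,1]≡1 : ∀ k → ℤGCD.gcd k (+ 1) ≡ + 1
gcd[k,1]≡1 k = cong +_ (ℕGCD.gcd-zeroʳ ℤ.∣ k ∣)

↥ℤtoℚ : ∀ k → ↥ (ℤtoℚ k) ≡ k
↥ℤtoℚ k = trans (sym (ℤP.*-identityʳ _))
  (trans (cong (↥ (ℤtoℚ k) ℤ.*_) (sym (gcd[k,1]≡1 k))) (ℚP.↥-/ k 1))

↧ℤtoℚ : ∀ k → ↧ (ℤtoℚ k) ≡ + 1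
↧ℤtoℚ k = trans (sym (ℤP.*-identityʳ _))
  (trans (cong (↧ (ℤtoℚ k) ℤ.*_) (sym (gcd[k,1]≡1 k))) (ℚP.↧-/ k 1))

coprime-1 : ∀ k → ℕC.Coprime ℤ.∣ k ∣ 1
coprime-1 k = ℕC.sym (ℕC.1-coprimeTo ℤ.∣ k ∣)

ℤtoℚ≡mkℚ : ∀ k → ℤtoℚ k ≡ mkℚ k 0 (coprime-1 k)
ℤtoℚ≡mkℚ k = ↥↧-injective _ _ (↥ℤtoℚ k) (↧ℤtoℚ k)

ℤtoℚ-+ : ∀ a b → ℤtoℚ (a ℤ.+ b) ≡ ℤtoℚ a ℚ.+ ℤtoℚ b
ℤtoℚ-+ a b rewrite ℤtoℚ≡mkℚ a | ℤtoℚ≡mkℚ b = cong (ℚ._/ 1) (+-*1 a b)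
  where
  +-*1 : ∀ (a b : ℤ) → a ℤ.+ b ≡ a ℤ.* + 1 ℤ.+ b ℤ.* + 1
  +-*1 = solve-∀

ℤtoℚ-neg : ∀ a → ℤtoℚ (ℤ.- a) ≡ ℚ.- ℤtoℚ a
ℤtoℚ-neg a = ↥↧-injective _ _
  (trans (↥ℤtoℚ (ℤ.- a)) (trans (cong ℤ.-_ (sym (↥ℤtoℚ a))) (sym (ℚP.↥-neg (ℤtoℚ a)))))
  (trans (↧ℤtoℚ (ℤ.- a)) (trans (sym (↧ℤtoℚ a)) (sym (ℚP.↧-neg (ℤtoℚ a)))))

ℤtoℚ-sub : ∀ a b → ℤtoℚ (a ℤ.- b) ≡ ℤtoℚ a ℚ.- ℤtoℚ b
ℤtoℚ-sub a b = trans (ℤtoℚ-+ a (ℤ.- b)) (cong (ℤtoℚ a ℚ.+_) (ℤtoℚ-neg b))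

↥ℤtoℚ*↧ : ∀ a b → ↥ (ℤtoℚ a) ℤ.* ↧ (ℤtoℚ b) ≡ a
↥ℤtoℚ*↧ a b = trans (cong₂ ℤ._*_ (↥ℤtoℚ a) (↧ℤtoℚ b)) (ℤP.*-identityʳ a)

ℤtoℚ-mono-≤ : ∀ {a b} → a ℤ.≤ b → ℤtoℚ a ℚ.≤ ℤtoℚ b
ℤtoℚ-mono-≤ {a} {b} a≤b = ℚ.*≤* (subst₂ ℤ._≤_ (sym (↥ℤtoℚ*↧ a b)) (sym (↥ℤtoℚ*↧ b a)) a≤b)

ℤtoℚ-cancel-≤ : ∀ {a b} → ℤtoℚ a ℚ.≤ ℤtoℚ b → a ℤ.≤ b
ℤtoℚ-cancel-≤ {a} {b} (ℚ.*≤* p) = subst₂ ℤ._≤_ (↥ℤtoℚ*↧ a b) (↥ℤtoℚ*↧ b a) p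

ℤtoℚ-mono-< : ∀ {a b} → a ℤ.< b → ℤtoℚ a ℚ.< ℤtoℚ b
ℤtoℚ-mono-< {a} {b} a<b = ℚ.*<* (subst₂ ℤ._<_ (sym (↥ℤtoℚ*↧ a b)) (sym (↥ℤtoℚ*↧ b a)) a<b)

ℤtoℚ-cancel-< : ∀ {a b} → ℤtoℚ a ℚ.< ℤtoℚ b → a ℤ.< b
ℤtoℚ-cancel-< {a} {b} (ℚ.*<* p) = subst₂ ℤ._<_ (↥ℤtoℚ*↧ a b) (↥ℤtoℚ*↧ b a) p

0≤ℤtoℚ+ : ∀ c → 0ℚ ℚ.≤ ℤtoℚ (+ c)
0≤ℤtoℚ+ c = ℤtoℚ-mono-≤ {+ 0} {+ c} (ℤ.+≤+ ℕ.z≤n)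

neg-involutive : ∀ (p : ℚ) → ℚ.- (ℚ.- p) ≡ p
neg-involutive = QS.solve 1 (λ p → QS.:- (QS.:- p) QS.:= p) refl

neg-sub : ∀ (p q : ℚ) → ℚ.- (p ℚ.- q) ≡ q ℚ.- p
neg-sub = QS.solve 2 (λ p q → QS.:- (p QS.:- q) QS.:= q QS.:- p) refl

p-0≡p : ∀ (p : ℚ) → p ℚ.- 0ℚ ≡ p
p-0≡p = QS.solve 1 (λ p → p QS.:- QS.con 0ℚ QS.:= p) refl

0-p≡-p : ∀ (p : ℚ) → 0ℚ ℚ.- p ≡ ℚ.- p
0-p≡-p = QS.solve 1 (λ p → QS.con 0ℚ QS.:- p QS.:= QS.:- p) refl

p≤q⇒0≤q-p : ∀ {p q} → p ℚ.≤ q → 0ℚ ℚ.≤ q ℚ.- p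
p≤q⇒0≤q-p {p} {q} p≤q = subst (ℚ._≤ q ℚ.- p) (ℚP.+-inverseʳ p) (ℚP.+-monoˡ-≤ (ℚ.- p) p≤q)

p<q⇒0<q-p : ∀ {p q} → p ℚ.< q → 0ℚ ℚ.< q ℚ.- p
p<q⇒0<q-p {p} {q} p<q = subst (ℚ._< q ℚ.- p) (ℚP.+-inverseʳ p) (ℚP.+-monoˡ-< (ℚ.- p) p<q)

≤∧≢⇒< : ∀ {p q} → p ℚ.≤ q → p ≢ q → p ℚ.< q
≤∧≢⇒< {p} {q} p≤q p≢q with ℚP.<-cmp p q
... | tri< p<q _ _ = p<q
... | tri≈ _ p≡q _ = ⊥-elim (p≢q p≡q)
... | tri> _ _ q<p = ⊥-elim (ℚP.<-irrefl refl (ℚP.<-≤-trans q<p p≤q))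

infix 4 _<[_]_
_<[_]_ : ℚ → Strictness → ℚ → Set
p <[ weak ]   q = p ℚ.≤ q
p <[ strict ] q = p ℚ.< q

<[]⇒≤ : ∀ {s p q} → p <[ s ] q → p ℚ.≤ q
<[]⇒≤ {weak}   p≤q = p≤q
<[]⇒≤ {strict} p<q = ℚP.<⇒≤ p<q

<⇒<[] : ∀ {s p q} → p ℚ.< q → p <[ s ] q
<⇒<[] {weak}   p<q = ℚP.<⇒≤ p<q
<⇒<[] {strict} p<q = p<q

<[]-<-trans : ∀ {s p q r} → p <[ s ] q → q ℚ.< r → p ℚ.< r
<[]-<-trans {weak}   = ℚP.≤-<-trans
<[]-<-trans {strict} = ℚP.<-trans

<-<[]-trans : ∀ {s p q r} → p ℚ.< q → q <[ s ] r → p ℚ.< r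
<-<[]-trans {weak}   = ℚP.<-≤-trans
<-<[]-trans {strict} = ℚP.<-trans

<[]-+-monoˡ : ∀ {s p q} r → p <[ s ] q → p ℚ.+ r <[ s ] q ℚ.+ r
<[]-+-monoˡ {weak}   r = ℚP.+-monoˡ-≤ r
<[]-+-monoˡ {strict} r = ℚP.+-monoˡ-< r

<[]-+-mono : ∀ {s t p q p′ q′} → p <[ s ] q → p′ <[ t ] q′ → p ℚ.+ p′ <[ s ⊕s t ] q ℚ.+ q′
<[]-+-mono {weak}   {weak}   = ℚP.+-mono-≤
<[]-+-mono {weak}   {strict} = ℚP.+-mono-≤-<
<[]-+-mono {strict} {weak}   = ℚP.+-mono-<-≤
<[]-+-mono {strict} {strict} = ℚP.+-mono-<

SatW⇒<[] : ∀ {q s c} → SatW q (fin s c) → q <[ s ] ℤtoℚ c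
SatW⇒<[] {s = weak}   h = h
SatW⇒<[] {s = strict} h = h

<[]⇒SatW : ∀ {q s c} → q <[ s ] ℤtoℚ c → SatW q (fin s c)
<[]⇒SatW {s = weak}   h = h
<[]⇒SatW {s = strict} h = h

<[]-FinLeq-trans : ∀ {s t c d q} → q <[ s ] ℤtoℚ c → FinLeq s c t d → q <[ t ] ℤtoℚ d
<[]-FinLeq-trans {s} h (<-fin c<d)    = <⇒<[] (<[]-<-trans {s} h (ℤtoℚ-mono-< c<d))
<[]-FinLeq-trans     h (strict-≤ c≤d) = <⇒<[] (ℚP.<-≤-trans h (ℤtoℚ-mono-≤ c≤d))
<[]-FinLeq-trans     h (weak-≤ c≤d)   = ℚP.≤-trans h (ℤtoℚ-mono-≤ c≤d)

SatW-mono : ∀ {q a b} → SatW q a → a ≤w b → SatW q b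
SatW-mono {a = fin _ _} {fin _ _} h a≤b = <[]⇒SatW (<[]-FinLeq-trans (SatW⇒<[] h) (≤w⇒FinLeq a≤b))
SatW-mono {a = fin _ _} {∞}       _ _   = tt
SatW-mono {a = ∞}       {∞}       _ _   = tt
SatW-mono {a = ∞}       {fin _ _} _ (inj₂ ())

SatW-+ : ∀ {p q a b} → SatW p a → SatW q b → SatW (p ℚ.+ q) (a ⊕ b)
SatW-+ {a = fin s c} {fin t d} h k =
  <[]⇒SatW (subst (_ <[ s ⊕s t ]_) (sym (ℤtoℚ-+ c d)) (<[]-+-mono {s} {t} (SatW⇒<[] h) (SatW⇒<[] k)))
SatW-+ {a = fin _ _} {∞} _ _ = tt
SatW-+ {a = ∞}           _ _ = tt

SatW-⊓w : ∀ {q a b} → SatW q a → SatW q b → SatW q (a ⊓w b)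
SatW-⊓w {q} {a} {b} h k with ⊓w-sel a b
... | inj₁ e rewrite e = h
... | inj₂ e rewrite e = k

minOver-sat : ∀ {m q} (f : Fin m → Weight) → (∀ u → SatW q (f u)) → SatW q (minOver f)
minOver-sat {zero}  f _   = tt
minOver-sat {suc m} f sat = SatW-⊓w (sat zero) (minOver-sat (f ∘ suc) (sat ∘ suc))

floor-spec : ∀ p → ℤtoℚ (ℚ.floor p) ℚ.≤ p × p ℚ.< ℤtoℚ (ℚ.floor p ℤ.+ + 1)
floor-spec (mkℚ n d c) = lower-bound , upper-bound
  where
  f : ℤ
  f = n ℤ./ (+ suc d)
  n*1≡n*↧ : ∀ k → n ℤ.* ↧ (ℤtoℚ k) ≡ n
  n*1≡n*↧ k = trans (cong (n ℤ.*_) (↧ℤtoℚ k)) (ℤP.*-identityʳ n)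
  suc[n/d]≡f+1 : ℤ.suc (n ℤD./ℕ suc d) ≡ f ℤ.+ + 1
  suc[n/d]≡f+1 = trans (ℤP.+-comm (+ 1) (n ℤD./ℕ suc d))
    (cong (ℤ._+ + 1) (sym (ℤD.div-pos-is-/ℕ n (suc d))))
  lower-bound : ℤtoℚ f ℚ.≤ mkℚ n d c
  lower-bound = ℚ.*≤* (subst₂ ℤ._≤_ (cong (ℤ._* + suc d) (sym (↥ℤtoℚ f))) (sym (n*1≡n*↧ f))
    (ℤD.[n/d]*d≤n n (+ suc d)))
  upper-bound : mkℚ n d c ℚ.< ℤtoℚ (f ℤ.+ + 1)
  upper-bound = ℚ.*<* (subst₂ ℤ._<_ (sym (n*1≡n*↧ (f ℤ.+ + 1)))
    (cong (ℤ._* + suc d) (trans suc[n/d]≡f+1 (sym (↥ℤtoℚ (f ℤ.+ + 1)))))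
    (ℤD.n<s[n/ℕd]*d n (suc d)))

floor-unique : ∀ p k → ℤtoℚ k ℚ.≤ p → p ℚ.< ℤtoℚ (k ℤ.+ + 1) → ℚ.floor p ≡ k
floor-unique p k k≤p p<k+1 = ℤP.≤-antisym
  (<+1⇒≤ (ℤtoℚ-cancel-< (ℚP.≤-<-trans (proj₁ (floor-spec p)) p<k+1)))
  (<+1⇒≤ (ℤtoℚ-cancel-< (ℚP.≤-<-trans k≤p (proj₂ (floor-spec p)))))

fracPart-between : ∀ q k → 0ℚ ℚ.< q → ℤtoℚ k ℚ.≤ q → q ℚ.< ℤtoℚ (k ℤ.+ + 1)
  → ℚ.fracPart q ≡ q ℚ.- ℤtoℚ k
fracPart-between q@(mkℚ _ _ _) k 0<q k≤q q<k+1 =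
  trans (cong (λ t → ℚ.∣ q ℚ.- ℤtoℚ t ∣) truncate≡k) (ℚP.0≤p⇒∣p∣≡p (p≤q⇒0≤q-p k≤q))
  where
  truncate≡k : ℚ.truncate q ≡ k
  truncate≡k with q ℚ.≤ᵇ 0ℚ in q≤ᵇ0
  ... | true  = ⊥-elim (ℚP.<-irrefl refl (ℚP.<-≤-trans 0<q (ℚP.≤ᵇ⇒≤ (subst T (sym q≤ᵇ0) tt))))
  ... | false = floor-unique q k k≤q q<k+1

-- Rounding rationals up to weights

data IsCeilW (d : ℚ) : Weight → Set where
  integral   : ∀ k → d ≡ ℤtoℚ k → IsCeilW d (fin weak k)
  fractional : ∀ k → ℤtoℚ (k ℤ.- + 1) ℚ.< d → d ℚ.< ℤtoℚ k → IsCeilW d (fin strict k)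

ceilW : ∀ d → Σ Weight (IsCeilW d)
ceilW d with d ℚP.≟ ℤtoℚ (ℚ.floor d)
... | yes d≡⌊d⌋ = fin weak (ℚ.floor d) , integral _ d≡⌊d⌋
... | no d≢⌊d⌋  = fin strict (ℚ.floor d ℤ.+ + 1) , fractional _
  (subst (λ t → ℤtoℚ t ℚ.< d) (sym (i+1-1≡i (ℚ.floor d)))
    (≤∧≢⇒< (proj₁ (floor-spec d)) (λ e → d≢⌊d⌋ (sym e))))
  (proj₂ (floor-spec d))

IsCeilW-least : ∀ {d w z} → IsCeilW d w → SatW d z → w ≤w z
IsCeilW-least {z = ∞} _ _ = ≤w-∞
IsCeilW-least {z = fin weak _}   (integral _ refl) h = FinLeq⇒≤w (weak-≤ (ℤtoℚ-cancel-≤ h))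
IsCeilW-least {z = fin strict _} (integral _ refl) h = FinLeq⇒≤w (<-fin (ℤtoℚ-cancel-< h))
IsCeilW-least {z = fin s c} (fractional k k-1<d _) h =
  FinLeq⇒≤w (strict-≤ (-1<⇒≤ (ℤtoℚ-cancel-< {k ℤ.- + 1} {c} (<-<[]-trans {s} k-1<d (SatW⇒<[] h)))))

IsCeilW-sat : ∀ {d w} → IsCeilW d w → SatW d w
IsCeilW-sat (integral _ refl)  = ℚP.≤-refl
IsCeilW-sat (fractional _ _ d<k) = d<k

IsCeilW-tight : ∀ {d w z} → IsCeilW d w → 0w ≤w z ⊕ w → SatW (ℚ.- d) z
IsCeilW-tight {z = ∞} _ _ = tt
IsCeilW-tight {z = fin weak c} (integral k refl) h =
  subst (ℚ._≤ ℤtoℚ c) (ℤtoℚ-neg k) (ℤtoℚ-mono-≤ (0≤a+b⇒-b≤a {c} {k} (FinLeq⇒≤ (≤w⇒FinLeq h))))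
IsCeilW-tight {z = fin strict c} (integral k refl) h with ≤w⇒FinLeq h
... | <-fin 0<c+k = subst (ℚ._< ℤtoℚ c) (ℤtoℚ-neg k) (ℤtoℚ-mono-< (0<a+b⇒-b<a {c} {k} 0<c+k))
IsCeilW-tight {d} {z = fin s c} (fractional k k-1<d _) h = <[]⇒SatW {s = s} (<⇒<[] (ℚP.<-≤-trans
  (subst (ℚ.- d ℚ.<_) (sym (ℤtoℚ-neg (k ℤ.- + 1))) (ℚP.neg-antimono-< k-1<d))
  (ℤtoℚ-mono-≤ (0<a+b⇒-[b-1]≤a {c} {k} (0≤w-fin-strict⇒0< s {c} {k} h)))))

IsCeilW-neg-nonneg : ∀ {d w w′} → IsCeilW d w → IsCeilW (ℚ.- d) w′ → 0w ≤w w ⊕ w′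
IsCeilW-neg-nonneg {d} dw dw′ = IsCeilW-least (integral (+ 0) refl)
  (subst (λ q → SatW q _) (ℚP.+-inverseʳ d) (SatW-+ (IsCeilW-sat dw) (IsCeilW-sat dw′)))

-- Satisfying distance graphs

module _ {n : ℕ} (v : Valuation n) (H : Graph n)
         (sat : ∀ a b → SatW (ext v b ℚ.- ext v a) (H a b)) where

  SatW-walk : ∀ {x y} (p : Walk x y) → SatW (ext v y ℚ.- ext v x) (walkWeight H p)
  SatW-walk {x} [] = ℚP.≤-reflexive (ℚP.+-inverseʳ (ext v x))
  SatW-walk {x} (_∷_ y {z} p) =
    subst (λ q → SatW q _) (telescope (ext v x) (ext v y) (ext v z)) (SatW-+ (sat x y) (SatW-walk p))
    where
    telescope : ∀ (a b c : ℚ) → (b ℚ.- a) ℚ.+ (c ℚ.- b) ≡ c ℚ.- a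
    telescope = QS.solve 3 (λ a b c → (b QS.:- a) QS.:+ (c QS.:- b) QS.:= c QS.:- a) refl

InInterval⇒SatW-upper : ∀ {b} (I : Interval b) p → InInterval p I → SatW p (upper I)
InInterval⇒SatW-upper (equal _ _)   _ p≡c         = ℚP.≤-reflexive p≡c
InInterval⇒SatW-upper (open' _ _ _) _ (_ , p<c)   = p<c
InInterval⇒SatW-upper above         _ _           = tt

InInterval⇒SatW-lower : ∀ {b} (I : Interval b) p → InInterval p I → SatW (ℚ.- p) (lower I)
InInterval⇒SatW-lower (equal c _) p refl = ℚP.≤-reflexive (sym (ℤtoℚ-neg (+ c)))
InInterval⇒SatW-lower (open' (suc c) _ _) p (c<p , _) =
  subst (ℚ.- p ℚ.<_) (trans (cong ℚ.-_ (sym (ℤtoℚ-sub (+ suc c) (+ 1)))) (sym (ℤtoℚ-neg (+ c))))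
    (ℚP.neg-antimono-< c<p)
InInterval⇒SatW-lower {b} above p b<p = subst (ℚ.- p ℚ.<_) (sym (ℤtoℚ-neg (+ b))) (ℚP.neg-antimono-< b<p)

InUnit : ℕ → ℚ → Set
InUnit c p = ℤtoℚ (+ c) ℚ.- ℤtoℚ (+ 1) ℚ.< p × p ℚ.< ℤtoℚ (+ c)

fracPart-InUnit : ∀ p c → 1 ℕ.≤ c → InUnit c p → ℚ.fracPart p ≡ p ℚ.- ℤtoℚ (+ c ℤ.- + 1)
fracPart-InUnit p (suc c) _ (c<p , p<c+1) =
  fracPart-between p (+ c) 0<p (ℚP.<⇒≤ c<p′) (subst (λ k → p ℚ.< ℤtoℚ k) (cong +_ (ℕP.+-comm 1 c)) p<c+1)
  where
  c<p′ : ℤtoℚ (+ c) ℚ.< p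
  c<p′ = subst (ℚ._< p) (sym (ℤtoℚ-sub (+ suc c) (+ 1))) c<p
  0<p : 0ℚ ℚ.< p
  0<p = ℚP.≤-<-trans (0≤ℤtoℚ+ c) c<p′

<[]-exchange : ∀ {s} a A b B → a ℚ.- A <[ s ] b ℚ.- B → a ℚ.- b <[ s ] A ℚ.- B
<[]-exchange {s} a A b B h = subst₂ _<[ s ]_ (cancel₁ a A b) (cancel₂ A b B) (<[]-+-monoˡ {s} (A ℚ.- b) h)
  where
  cancel₁ : ∀ (a A b : ℚ) → (a ℚ.- A) ℚ.+ (A ℚ.- b) ≡ a ℚ.- b
  cancel₁ = QS.solve 3 (λ a A b → (a QS.:- A) QS.:+ (A QS.:- b) QS.:= a QS.:- b) refl
  cancel₂ : ∀ (A b B : ℚ) → (b ℚ.- B) ℚ.+ (A ℚ.- b) ≡ A ℚ.- B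
  cancel₂ = QS.solve 3 (λ A b B → (b QS.:- B) QS.:+ (A QS.:- b) QS.:= A QS.:- B) refl

fracPart-<[]⇒-<[] : ∀ {s} p c q d → 1 ℕ.≤ c → 1 ℕ.≤ d → InUnit c p → InUnit d q
  → ℚ.fracPart q <[ s ] ℚ.fracPart p → q ℚ.- p <[ s ] ℤtoℚ (+ d ℤ.- + c)
fracPart-<[]⇒-<[] {s} p c q d 1≤c 1≤d p∈ q∈ h =
  subst (q ℚ.- p <[ s ]_) (trans (sym (ℤtoℚ-sub (+ d ℤ.- + 1) (+ c ℤ.- + 1))) (cong ℤtoℚ ([j-1]-[i-1]≡j-i (+ c) (+ d))))
    (<[]-exchange {s} q (ℤtoℚ (+ d ℤ.- + 1)) p (ℤtoℚ (+ c ℤ.- + 1))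
      (subst₂ _<[ s ]_ (fracPart-InUnit q d 1≤d q∈) (fracPart-InUnit p c 1≤c p∈) h))

fromXY-sat : ∀ {b b′} (I : Interval b) (J : Interval b′) k p q → InInterval p I → InInterval q J
  → (IsOpen I → IsOpen J → SatFrac p q k) → SatW (q ℚ.- p) (fromXY I J k)
fromXY-sat (equal _ _)   _             _  _ _ _ _ _ = tt
fromXY-sat above         _             _  _ _ _ _ _ = tt
fromXY-sat (open' _ _ _) (equal _ _)   _  _ _ _ _ _ = tt
fromXY-sat (open' _ _ _) above         _  _ _ _ _ _ = tt
fromXY-sat (open' _ _ _) (open' _ _ _) lt _ _ _ _ _ = tt
fromXY-sat (open' c 1≤c _) (open' d 1≤d _) eq p q p∈ q∈ f =
  fracPart-<[]⇒-<[] {weak} p c q d 1≤c 1≤d p∈ q∈ (ℚP.≤-reflexive (sym (f tt tt)))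
fromXY-sat (open' c 1≤c _) (open' d 1≤d _) gt p q p∈ q∈ f =
  fracPart-<[]⇒-<[] {strict} p c q d 1≤c 1≤d p∈ q∈ (f tt tt)

fromYX-sat : ∀ {b b′} (J : Interval b′) (I : Interval b) k q p → InInterval q J → InInterval p I
  → (IsOpen J → IsOpen I → SatFrac q p k) → SatW (q ℚ.- p) (fromYX J I k)
fromYX-sat (equal _ _)   _             _  _ _ _ _ _ = tt
fromYX-sat above         _             _  _ _ _ _ _ = tt
fromYX-sat (open' _ _ _) (equal _ _)   _  _ _ _ _ _ = tt
fromYX-sat (open' _ _ _) above         _  _ _ _ _ _ = tt
fromYX-sat (open' d 1≤d _) (open' c 1≤c _) lt q p q∈ p∈ f =
  fracPart-<[]⇒-<[] {strict} p c q d 1≤c 1≤d p∈ q∈ (f tt tt)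
fromYX-sat (open' d 1≤d _) (open' c 1≤c _) eq q p q∈ p∈ f =
  fracPart-<[]⇒-<[] {weak} p c q d 1≤c 1≤d p∈ q∈ (ℚP.≤-reflexive (f tt tt))
fromYX-sat (open' _ _ _) (open' _ _ _) gt _ _ _ _ _ = tt

regionGraph-sat : ∀ {n} {α : Fin n → ℕ} (R : Region α) v → v ∈R R
  → ∀ a b → SatW (ext v b ℚ.- ext v a) (regionGraph R a b)
regionGraph-sat R v _ zero zero = tt
regionGraph-sat R v (_ , v∈ , _) zero (suc x) =
  subst (λ q → SatW q _) (sym (p-0≡p (v x))) (InInterval⇒SatW-upper (interval R x) (v x) (v∈ x))
regionGraph-sat R v (_ , v∈ , _) (suc x) zero =
  subst (λ q → SatW q _) (sym (0-p≡-p (v x))) (InInterval⇒SatW-lower (interval R x) (v x) (v∈ x))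
regionGraph-sat R v (_ , v∈ , v-frac) (suc x) (suc y) with x Fin.≟ y
... | yes _ = tt
... | no x≢y = SatW-⊓w
  (fromXY-sat (interval R x) (interval R y) (frac R x y) (v x) (v y) (v∈ x) (v∈ y) (v-frac x y x≢y))
  (fromYX-sat (interval R y) (interval R x) (frac R y x) (v y) (v x) (v∈ y) (v∈ x) (v-frac y x (x≢y ∘ sym)))

module _ {n : ℕ} {G H C D : Graph n}
         (canonicalC : IsCanonicalFormOf G C) (canonicalD : IsCanonicalFormOf H D) where

  -- ⌈v x - v y⌉ is below every walk weight from y to x, hence below C y x; symmetrically for D.
  common-solution⇒0≤cycle : ∀ (v : Valuation n)
    → (∀ a b → SatW (ext v b ℚ.- ext v a) (G a b))
    → (∀ a b → SatW (ext v b ℚ.- ext v a) (H a b))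
    → ∀ x y → 0w ≤w C y x ⊕ D x y
  common-solution⇒0≤cycle v satG satH x y
    with ceilW (ext v x ℚ.- ext v y) | ceilW (ℚ.- (ext v x ℚ.- ext v y))
  ... | w , ceil | w′ , ceil′ = ≤w-trans (IsCeilW-neg-nonneg ceil ceil′) (⊕-mono-≤w w≤C w′≤D)
    where
    w≤C : w ≤w C y x
    w≤C = Canonical.glb canonicalC y x w (λ p → IsCeilW-least ceil (SatW-walk v G satG p))
    w′≤D : w′ ≤w D x y
    w′≤D = Canonical.glb canonicalD x y w′ (λ p → IsCeilW-least ceil′
      (subst (λ q → SatW q (walkWeight H p)) (sym (neg-sub (ext v x) (ext v y))) (SatW-walk v H satH p)))

-- Solving distance graphs one clock at a time

Bound : Set
Bound = Maybe (ℚ × Strictness)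

LowerSat : Bound → ℚ → Set
LowerSat nothing        _ = ⊤
LowerSat (just (l , s)) q = l <[ s ] q

UpperSat : Bound → ℚ → Set
UpperSat nothing        _ = ⊤
UpperSat (just (u , t)) q = q <[ t ] u

Compatible : Bound → Bound → Set
Compatible (just (l , s)) (just (u , t)) = l <[ s ⊕s t ] u
Compatible _              _              = ⊤

tighterLower : Bound → Bound → Bound
tighterLower nothing  y       = y
tighterLower (just x) nothing = just x
tighterLower (just (l₁ , s₁)) (just (l₂ , s₂)) with ℚP.<-cmp l₁ l₂
... | tri< _ _ _ = just (l₂ , s₂)
... | tri> _ _ _ = just (l₁ , s₁)
... | tri≈ _ _ _ with s₁
...   | strict = just (l₁ , s₁)
...   | weak = just (l₂ , s₂)

tighterLower-sel : ∀ x y → (tighterLower x y ≡ x) ⊎ (tighterLower x y ≡ y)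
tighterLower-sel nothing  y       = inj₂ refl
tighterLower-sel (just x) nothing = inj₁ refl
tighterLower-sel (just (l₁ , s₁)) (just (l₂ , s₂)) with ℚP.<-cmp l₁ l₂
... | tri< _ _ _ = inj₂ refl
... | tri> _ _ _ = inj₁ refl
... | tri≈ _ _ _ with s₁
...   | strict = inj₁ refl
...   | weak = inj₂ refl

tighterLower-sat : ∀ x y q → LowerSat (tighterLower x y) q → LowerSat x q × LowerSat y q
tighterLower-sat nothing  y       q h = tt , h
tighterLower-sat (just x) nothing q h = h , tt
tighterLower-sat (just (l₁ , s₁)) (just (l₂ , s₂)) q h with ℚP.<-cmp l₁ l₂
... | tri< l₁<l₂ _ _ = <⇒<[] {s₁} (ℚP.<-≤-trans l₁<l₂ (<[]⇒≤ {s₂} h)) , h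
... | tri> _ _ l₂<l₁ = h , <⇒<[] {s₂} (ℚP.<-≤-trans l₂<l₁ (<[]⇒≤ {s₁} h))
... | tri≈ _ refl _ with s₁
...   | strict = h , <⇒<[] {s₂} h
...   | weak = <[]⇒≤ {s₂} h , h

tighterUpper : Bound → Bound → Bound
tighterUpper nothing  y       = y
tighterUpper (just x) nothing = just x
tighterUpper (just (u₁ , t₁)) (just (u₂ , t₂)) with ℚP.<-cmp u₁ u₂
... | tri< _ _ _ = just (u₁ , t₁)
... | tri> _ _ _ = just (u₂ , t₂)
... | tri≈ _ _ _ with t₁
...   | strict = just (u₁ , t₁)
...   | weak = just (u₂ , t₂)

tighterUpper-sel : ∀ x y → (tighterUpper x y ≡ x) ⊎ (tighterUpper x y ≡ y)
tighterUpper-sel nothing  y       = inj₂ refl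
tighterUpper-sel (just x) nothing = inj₁ refl
tighterUpper-sel (just (u₁ , t₁)) (just (u₂ , t₂)) with ℚP.<-cmp u₁ u₂
... | tri< _ _ _ = inj₁ refl
... | tri> _ _ _ = inj₂ refl
... | tri≈ _ _ _ with t₁
...   | strict = inj₁ refl
...   | weak = inj₂ refl

tighterUpper-sat : ∀ x y q → UpperSat (tighterUpper x y) q → UpperSat x q × UpperSat y q
tighterUpper-sat nothing  y       q h = tt , h
tighterUpper-sat (just x) nothing q h = h , tt
tighterUpper-sat (just (u₁ , t₁)) (just (u₂ , t₂)) q h with ℚP.<-cmp u₁ u₂
... | tri< u₁<u₂ _ _ = h , <⇒<[] {t₂} (ℚP.≤-<-trans (<[]⇒≤ {t₁} h) u₁<u₂)
... | tri> _ _ u₂<u₁ = <⇒<[] {t₁} (ℚP.≤-<-trans (<[]⇒≤ {t₂} h) u₂<u₁) , h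
... | tri≈ _ refl _ with t₁
...   | strict = h , <⇒<[] {t₂} h
...   | weak = <[]⇒≤ {t₂} h , h

q<q+1 : ∀ q → q ℚ.< q ℚ.+ 1ℚ
q<q+1 q = subst (ℚ._< q ℚ.+ 1ℚ) (ℚP.+-identityʳ q) (ℚP.+-monoʳ-< q (ℚ.*<* (ℤ.+<+ (ℕ.s≤s ℕ.z≤n))))

q-1<q : ∀ q → q ℚ.- 1ℚ ℚ.< q
q-1<q q = subst (q ℚ.- 1ℚ ℚ.<_) (sub-add q) (q<q+1 (q ℚ.- 1ℚ))
  where
  sub-add : ∀ q → q ℚ.- 1ℚ ℚ.+ 1ℚ ≡ q
  sub-add = QS.solve 1 (λ q → q QS.:- QS.con 1ℚ QS.:+ QS.con 1ℚ QS.:= q) refl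

between : ∀ l u → Compatible l u → Σ ℚ (λ q → LowerSat l q × UpperSat u q)
between nothing             nothing             _ = 0ℚ , tt , tt
between (just (l , s))      nothing             _ = l ℚ.+ 1ℚ , <⇒<[] {s} (q<q+1 l) , tt
between nothing             (just (u , t))      _ = u ℚ.- 1ℚ , tt , <⇒<[] {t} (q-1<q u)
between (just (l , weak))   (just (u , weak))   l≤u = l , ℚP.≤-refl , l≤u
between (just (l , weak))   (just (u , strict)) l<u with ℚP.<-dense l<u
... | m , l<m , m<u = m , ℚP.<⇒≤ l<m , m<u
between (just (l , strict)) (just (u , t))      l<u with ℚP.<-dense l<u
... | m , l<m , m<u = m , l<m , <⇒<[] {t} m<u

module _ {X : Set} (L U : X → Bound) where

  tightestLower : List X → Bound
  tightestLower []       = nothing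
  tightestLower (a ∷ xs) = tighterLower (L a) (tightestLower xs)

  tightestUpper : List X → Bound
  tightestUpper []       = nothing
  tightestUpper (a ∷ xs) = tighterUpper (U a) (tightestUpper xs)

  tightestLower-sat : ∀ xs q → LowerSat (tightestLower xs) q → ∀ {a} → a ∈ xs → LowerSat (L a) q
  tightestLower-sat (b ∷ xs) q h (here refl) = proj₁ (tighterLower-sat (L b) (tightestLower xs) q h)
  tightestLower-sat (b ∷ xs) q h (there a∈) =
    tightestLower-sat xs q (proj₂ (tighterLower-sat (L b) (tightestLower xs) q h)) a∈

  tightestUpper-sat : ∀ xs q → UpperSat (tightestUpper xs) q → ∀ {a} → a ∈ xs → UpperSat (U a) q
  tightestUpper-sat (b ∷ xs) q h (here refl) = proj₁ (tighterUpper-sat (U b) (tightestUpper xs) q h)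
  tightestUpper-sat (b ∷ xs) q h (there a∈) =
    tightestUpper-sat xs q (proj₂ (tighterUpper-sat (U b) (tightestUpper xs) q h)) a∈

  tightestLower-attained : ∀ xs → tightestLower xs ≡ nothing ⊎ Σ X (λ a → a ∈ xs × tightestLower xs ≡ L a)
  tightestLower-attained [] = inj₁ refl
  tightestLower-attained (b ∷ xs) with tighterLower-sel (L b) (tightestLower xs)
  ... | inj₁ e = inj₂ (b , here refl , e)
  ... | inj₂ e with tightestLower-attained xs
  ...   | inj₁ e′ = inj₁ (trans e e′)
  ...   | inj₂ (a , a∈ , e′) = inj₂ (a , there a∈ , trans e e′)

  tightestUpper-attained : ∀ xs → tightestUpper xs ≡ nothing ⊎ Σ X (λ a → a ∈ xs × tightestUpper xs ≡ U a)
  tightestUpper-attained [] = inj₁ refl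
  tightestUpper-attained (b ∷ xs) with tighterUpper-sel (U b) (tightestUpper xs)
  ... | inj₁ e = inj₂ (b , here refl , e)
  ... | inj₂ e with tightestUpper-attained xs
  ...   | inj₁ e′ = inj₁ (trans e e′)
  ...   | inj₂ (a , a∈ , e′) = inj₂ (a , there a∈ , trans e e′)

  between-all : ∀ xs → (∀ {a b} → a ∈ xs → b ∈ xs → Compatible (L a) (U b))
    → Σ ℚ (λ q → ∀ {a} → a ∈ xs → LowerSat (L a) q × UpperSat (U a) q)
  between-all xs compatible with between (tightestLower xs) (tightestUpper xs) tightest-compatible
    where
    compatible-nothingʳ : ∀ l → Compatible l nothing
    compatible-nothingʳ nothing  = tt
    compatible-nothingʳ (just _) = tt
    tightest-compatible : Compatible (tightestLower xs) (tightestUpper xs)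
    tightest-compatible with tightestLower-attained xs | tightestUpper-attained xs
    ... | inj₁ e | _ rewrite e = tt
    ... | inj₂ _ | inj₁ e′ rewrite e′ = compatible-nothingʳ (tightestLower xs)
    ... | inj₂ (a , a∈ , e) | inj₂ (b , b∈ , e′) rewrite e | e′ = compatible a∈ b∈
  ... | q , lower , upper = q , λ a∈ → tightestLower-sat xs q lower a∈ , tightestUpper-sat xs q upper a∈

lowerBoundFrom : ℚ → Weight → Bound
lowerBoundFrom p (fin s c) = just (p ℚ.- ℤtoℚ c , s)
lowerBoundFrom p ∞         = nothing

upperBoundFrom : ℚ → Weight → Bound
upperBoundFrom p (fin s c) = just (p ℚ.+ ℤtoℚ c , s)
upperBoundFrom p ∞         = nothing

lowerBoundFrom-sat : ∀ p w q → LowerSat (lowerBoundFrom p w) q → SatW (p ℚ.- q) w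
lowerBoundFrom-sat p (fin s c) q h =
  <[]⇒SatW {s = s} (subst₂ _<[ s ]_ (cancel₁ p (ℤtoℚ c) q) (cancel₂ (ℤtoℚ c) q) (<[]-+-monoˡ {s} (ℤtoℚ c ℚ.- q) h))
  where
  cancel₁ : ∀ p c q → p ℚ.- c ℚ.+ (c ℚ.- q) ≡ p ℚ.- q
  cancel₁ = QS.solve 3 (λ p c q → p QS.:- c QS.:+ (c QS.:- q) QS.:= p QS.:- q) refl
  cancel₂ : ∀ c q → q ℚ.+ (c ℚ.- q) ≡ c
  cancel₂ = QS.solve 2 (λ c q → q QS.:+ (c QS.:- q) QS.:= c) refl
lowerBoundFrom-sat p ∞ q h = tt

upperBoundFrom-sat : ∀ p w q → UpperSat (upperBoundFrom p w) q → SatW (q ℚ.- p) w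
upperBoundFrom-sat p (fin s c) q h =
  <[]⇒SatW {s = s} (subst (q ℚ.- p <[ s ]_) (cancel p (ℤtoℚ c)) (<[]-+-monoˡ {s} (ℚ.- p) h))
  where
  cancel : ∀ p c → p ℚ.+ c ℚ.+ ℚ.- p ≡ c
  cancel = QS.solve 2 (λ p c → p QS.:+ c QS.:+ QS.:- p QS.:= c) refl
upperBoundFrom-sat p ∞ q h = tt

-- The bounds that x and y put on a new clock i, through the edges i → x and y → i,
-- are compatible as soon as the triangle y → i → x is satisfied.
boundsFrom-compatible : ∀ px py wx wy → SatW (px ℚ.- py) (wy ⊕ wx)
  → Compatible (lowerBoundFrom px wx) (upperBoundFrom py wy)
boundsFrom-compatible px py (fin sx cx) (fin sy cy) h =
  subst (λ s → px ℚ.- ℤtoℚ cx <[ s ] py ℚ.+ ℤtoℚ cy) (⊕s-comm sy sx)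
    (subst₂ _<[ sy ⊕s sx ]_ (cancel₁ px py (ℤtoℚ cx))
      (trans (cong (ℚ._+ (py ℚ.- ℤtoℚ cx)) (ℤtoℚ-+ cy cx)) (cancel₂ py (ℤtoℚ cx) (ℤtoℚ cy)))
      (<[]-+-monoˡ {sy ⊕s sx} (py ℚ.- ℤtoℚ cx) (SatW⇒<[] {s = sy ⊕s sx} h)))
  where
  cancel₁ : ∀ px py cx → px ℚ.- py ℚ.+ (py ℚ.- cx) ≡ px ℚ.- cx
  cancel₁ = QS.solve 3 (λ px py cx → px QS.:- py QS.:+ (py QS.:- cx) QS.:= px QS.:- cx) refl
  cancel₂ : ∀ py cx cy → cy ℚ.+ cx ℚ.+ (py ℚ.- cx) ≡ py ℚ.+ cy
  cancel₂ = QS.solve 3 (λ py cx cy → cy QS.:+ cx QS.:+ (py QS.:- cx) QS.:= py QS.:+ cy) refl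
boundsFrom-compatible _ _ (fin _ _) ∞         _ = tt
boundsFrom-compatible _ _ ∞         (fin _ _) _ = tt
boundsFrom-compatible _ _ ∞         ∞         _ = tt

WithZero : ∀ {n} → (Fin n → Set) → Vertex n → Set
WithZero P zero    = ⊤
WithZero P (suc j) = P j

WithZero? : ∀ {n} {P : Fin n → Set} → (∀ j → Dec (P j)) → ∀ x → Dec (WithZero P x)
WithZero? P? zero    = yes tt
WithZero? P? (suc j) = P? j

WithZero-mono : ∀ {n} {P Q : Fin n → Set} → (∀ j → Q j → P j) → ∀ x → WithZero Q x → WithZero P x
WithZero-mono Q⊆P zero    _  = tt
WithZero-mono Q⊆P (suc j) Qj = Q⊆P j Qj

module Extension {n : ℕ} (C : Graph n)
  (triangle : ∀ x y (k : Fin n) → C x y ≤w C x (suc k) ⊕ C (suc k) y)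
  (diagonal : ∀ k → SatW 0ℚ (C (suc k) (suc k))) where

  SatOn : (Fin n → Set) → Valuation n → Set
  SatOn P v = ∀ x y → WithZero P x → WithZero P y → SatW (ext v y ℚ.- ext v x) (C x y)

  SatOn-anti : ∀ {P Q : Fin n → Set} {v} → (∀ j → Q j → P j) → SatOn P v → SatOn Q v
  SatOn-anti Q⊆P sat x y Qx Qy = sat x y (WithZero-mono Q⊆P x Qx) (WithZero-mono Q⊆P y Qy)

  Extends : (Fin n → Set) → Valuation n → Valuation n → Set
  Extends P v v′ = ∀ j → P j → v′ j ≡ v j

  value-for : ∀ (P : Fin n → Set) → (∀ j → Dec (P j)) → ∀ v → SatOn P v → ∀ i
    → Σ ℚ (λ q → (∀ x → WithZero P x → SatW (ext v x ℚ.- q) (C (suc i) x))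
               × (∀ x → WithZero P x → SatW (q ℚ.- ext v x) (C x (suc i))))
  value-for P P? v sat i = q , sat-out , sat-in
    where
    L U : Vertex n → Bound
    L x with WithZero? P? x
    ... | yes _ = lowerBoundFrom (ext v x) (C (suc i) x)
    ... | no _  = nothing
    U x with WithZero? P? x
    ... | yes _ = upperBoundFrom (ext v x) (C x (suc i))
    ... | no _  = nothing
    compatible : ∀ {a b} → a ∈ allFin (suc n) → b ∈ allFin (suc n) → Compatible (L a) (U b)
    compatible {a} {b} _ _ with WithZero? P? a | WithZero? P? b
    ... | yes Pa | yes Pb = boundsFrom-compatible (ext v a) (ext v b) (C (suc i) a) (C b (suc i))
                              (SatW-mono (sat b a Pb Pa) (triangle b a i))
    ... | yes _  | no _ with C (suc i) a
    ...   | fin _ _ = tt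
    ...   | ∞       = tt
    compatible {a} {b} _ _ | no _ | _ = tt
    chosen : Σ ℚ (λ q → ∀ {a} → a ∈ allFin (suc n) → LowerSat (L a) q × UpperSat (U a) q)
    chosen = between-all L U (allFin (suc n)) compatible
    q : ℚ
    q = proj₁ chosen
    sat-out : ∀ x → WithZero P x → SatW (ext v x ℚ.- q) (C (suc i) x)
    sat-out x Px with WithZero? P? x | proj₁ (proj₂ chosen (∈-allFin x))
    ... | yes _  | h = lowerBoundFrom-sat (ext v x) (C (suc i) x) q h
    ... | no ¬Px | _ = ⊥-elim (¬Px Px)
    sat-in : ∀ x → WithZero P x → SatW (q ℚ.- ext v x) (C x (suc i))
    sat-in x Px with WithZero? P? x | proj₂ (proj₂ chosen (∈-allFin x))
    ... | yes _  | h = upperBoundFrom-sat (ext v x) (C x (suc i)) q h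
    ... | no ¬Px | _ = ⊥-elim (¬Px Px)

  extend-by : ∀ (P : Fin n → Set) → (∀ j → Dec (P j)) → ∀ v → SatOn P v → ∀ i
    → Σ (Valuation n) (λ v′ → SatOn (λ j → P j ⊎ j ≡ i) v′ × Extends P v v′)
  extend-by P P? v sat i with P? i
  ... | yes Pi = v , SatOn-anti P∪i⊆P sat , (λ _ _ → refl)
    where
    P∪i⊆P : ∀ j → P j ⊎ j ≡ i → P j
    P∪i⊆P j (inj₁ Pj)   = Pj
    P∪i⊆P j (inj₂ refl) = Pi
  ... | no ¬Pi with value-for P P? v sat i
  ...   | q , sat-out , sat-in = v′ , sat′ , agree
    where
    v′ : Valuation n
    v′ = updateAt v i (λ _ → q)
    v′i≡q : ext v′ (suc i) ≡ q
    v′i≡q = updateAt-updates i v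
    agree : Extends P v v′
    agree j Pj = updateAt-minimal j i v (λ j≡i → ¬Pi (subst P j≡i Pj))
    old-or-new : ∀ x → WithZero (λ j → P j ⊎ j ≡ i) x → (WithZero P x × ext v′ x ≡ ext v x) ⊎ x ≡ suc i
    old-or-new zero    _           = inj₁ (tt , refl)
    old-or-new (suc j) (inj₁ Pj)   = inj₁ (Pj , agree j Pj)
    old-or-new (suc j) (inj₂ refl) = inj₂ refl
    sat′ : SatOn (λ j → P j ⊎ j ≡ i) v′
    sat′ x y Px Py with old-or-new x Px | old-or-new y Py
    ... | inj₁ (Px′ , ex) | inj₁ (Py′ , ey) rewrite ex | ey = sat x y Px′ Py′
    ... | inj₁ (Px′ , ex) | inj₂ refl rewrite ex | v′i≡q = sat-in x Px′
    ... | inj₂ refl | inj₁ (Py′ , ey) rewrite ey | v′i≡q = sat-out y Py′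
    ... | inj₂ refl | inj₂ refl rewrite v′i≡q =
      subst (λ p → SatW p _) (sym (ℚP.+-inverseʳ q)) (diagonal i)

  extend-by-all : ∀ (L : List (Fin n)) (P : Fin n → Set) → (∀ j → Dec (P j)) → ∀ v → SatOn P v
    → Σ (Valuation n) (λ v′ → SatOn (λ j → P j ⊎ j ∈ L) v′ × Extends P v v′)
  extend-by-all [] P P? v sat = v , SatOn-anti P∪[]⊆P sat , (λ _ _ → refl)
    where
    P∪[]⊆P : ∀ j → P j ⊎ j ∈ [] → P j
    P∪[]⊆P j (inj₁ Pj) = Pj
    P∪[]⊆P j (inj₂ ())
  extend-by-all (i ∷ L) P P? v sat with extend-by-all L P P? v sat
  ... | v₁ , sat₁ , agree₁
      with extend-by (λ j → P j ⊎ j ∈ L) (λ j → P? j Dec.⊎-dec any? (j Fin.≟_) L) v₁ sat₁ i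
  ...   | v₂ , sat₂ , agree₂ = v₂ , SatOn-anti split sat₂ , (λ j Pj → trans (agree₂ j (inj₁ Pj)) (agree₁ j Pj))
    where
    split : ∀ j → P j ⊎ j ∈ i ∷ L → (P j ⊎ j ∈ L) ⊎ j ≡ i
    split j (inj₁ Pj)           = inj₁ (inj₁ Pj)
    split j (inj₂ (here refl))  = inj₂ refl
    split j (inj₂ (there j∈L))  = inj₁ (inj₂ j∈L)

  extend-to-all : ∀ (P : Fin n → Set) → (∀ j → Dec (P j)) → ∀ v → SatOn P v
    → Σ (Valuation n) (λ v′ → (∀ x y → SatW (ext v′ y ℚ.- ext v′ x) (C x y)) × Extends P v v′)
  extend-to-all P P? v sat with extend-by-all (allFin n) P P? v sat
  ... | v′ , sat′ , agree = v′ , (λ x y → sat′ x y (everything x) (everything y)) , agree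
    where
    everything : ∀ x → WithZero (λ j → P j ⊎ j ∈ allFin n) x
    everything zero    = tt
    everything (suc j) = inj₂ (∈-allFin j)

-- A point of the region

count : ∀ {n} {P : Fin n → Set} → (∀ z → Dec (P z)) → ℕ
count {zero}  P? = 0
count {suc n} P? with P? zero
... | yes _ = suc (count (P? ∘ suc))
... | no _  = count (P? ∘ suc)

count≤n : ∀ {n} {P : Fin n → Set} (P? : ∀ z → Dec (P z)) → count P? ℕ.≤ n
count≤n {zero}  P? = ℕ.z≤n
count≤n {suc n} P? with P? zero
... | yes _ = ℕ.s≤s (count≤n (P? ∘ suc))
... | no _  = ℕP.m≤n⇒m≤1+n (count≤n (P? ∘ suc))

count-mono : ∀ {n} {P Q : Fin n → Set} (P? : ∀ z → Dec (P z)) (Q? : ∀ z → Dec (Q z))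
  → (∀ z → P z → Q z) → count P? ℕ.≤ count Q?
count-mono {zero}  P? Q? P⊆Q = ℕ.z≤n
count-mono {suc n} P? Q? P⊆Q with P? zero | Q? zero
... | yes _  | yes _  = ℕ.s≤s (count-mono (P? ∘ suc) (Q? ∘ suc) (P⊆Q ∘ suc))
... | yes P0 | no ¬Q0 = ⊥-elim (¬Q0 (P⊆Q zero P0))
... | no _   | yes _  = ℕP.m≤n⇒m≤1+n (count-mono (P? ∘ suc) (Q? ∘ suc) (P⊆Q ∘ suc))
... | no _   | no _   = count-mono (P? ∘ suc) (Q? ∘ suc) (P⊆Q ∘ suc)

count-strictMono : ∀ {n} {P Q : Fin n → Set} (P? : ∀ z → Dec (P z)) (Q? : ∀ z → Dec (Q z))
  → (∀ z → P z → Q z) → ∀ w → Q w → ¬ P w → count P? ℕ.< count Q?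
count-strictMono {suc n} P? Q? P⊆Q zero Qw ¬Pw with P? zero | Q? zero
... | yes Pw | _      = ⊥-elim (¬Pw Pw)
... | no _   | no ¬Qw = ⊥-elim (¬Qw Qw)
... | no _   | yes _  = ℕ.s≤s (count-mono (P? ∘ suc) (Q? ∘ suc) (P⊆Q ∘ suc))
count-strictMono {suc n} P? Q? P⊆Q (suc w) Qw ¬Pw with P? zero | Q? zero
... | yes _  | yes _  = ℕ.s≤s (count-strictMono (P? ∘ suc) (Q? ∘ suc) (P⊆Q ∘ suc) w Qw ¬Pw)
... | yes P0 | no ¬Q0 = ⊥-elim (¬Q0 (P⊆Q zero P0))
... | no _   | yes _  = ℕP.m≤n⇒m≤1+n (count-strictMono (P? ∘ suc) (Q? ∘ suc) (P⊆Q ∘ suc) w Qw ¬Pw)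
... | no _   | no _   = count-strictMono (P? ∘ suc) (Q? ∘ suc) (P⊆Q ∘ suc) w Qw ¬Pw

count-cong : ∀ {n} {P Q : Fin n → Set} (P? : ∀ z → Dec (P z)) (Q? : ∀ z → Dec (Q z))
  → (∀ z → P z → Q z) → (∀ z → Q z → P z) → count P? ≡ count Q?
count-cong P? Q? P⊆Q Q⊆P = ℕP.≤-antisym (count-mono P? Q? P⊆Q) (count-mono Q? P? Q⊆P)

Offset : ℚ → Set
Offset t = 0ℚ ℚ.< t × t ℚ.< 1ℚ

2+ : ℕ → ℚ
2+ n = mkℚ (+ suc (suc n)) 0 (coprime-1 (+ suc (suc n)))

fraction : ℕ → ℕ → ℚ
fraction n r = ℤtoℚ (+ suc r) ℚ.* ℚ.1/ 2+ n

fraction-mono : ∀ n {r r′} → r ℕ.< r′ → fraction n r ℚ.< fraction n r′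
fraction-mono n {r} {r′} r<r′ = ℚP.*-monoˡ-<-pos (ℚ.1/ 2+ n) (ℤtoℚ-mono-< {+ suc r} {+ suc r′} (ℤ.+<+ (ℕ.s≤s r<r′)))

fraction-offset : ∀ n r → r ℕ.≤ n → Offset (fraction n r)
fraction-offset n r r≤n =
  subst (ℚ._< fraction n r) (ℚP.*-zeroˡ (ℚ.1/ 2+ n))
    (ℚP.*-monoˡ-<-pos (ℚ.1/ 2+ n) (ℤtoℚ-mono-< {+ 0} {+ suc r} (ℤ.+<+ (ℕ.s≤s ℕ.z≤n)))) ,
  subst (fraction n r ℚ.<_) (trans (cong (ℚ._* ℚ.1/ 2+ n) (ℤtoℚ≡mkℚ (+ suc (suc n)))) (ℚP.*-inverseʳ (2+ n)))
    (ℚP.*-monoˡ-<-pos (ℚ.1/ 2+ n) (ℤtoℚ-mono-< {+ suc r} {+ suc (suc n)} (ℤ.+<+ (ℕ.s≤s (ℕ.s≤s r≤n)))))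

IsBounded : ∀ {b} → Interval b → Set
IsBounded (equal _ _)   = ⊤
IsBounded (open' _ _ _) = ⊤
IsBounded above         = ⊥

IsBounded? : ∀ {b} (I : Interval b) → Dec (IsBounded I)
IsBounded? (equal _ _)   = yes tt
IsBounded? (open' _ _ _) = yes tt
IsBounded? above         = no (λ ())

IsOpen? : ∀ {b} (I : Interval b) → Dec (IsOpen I)
IsOpen? (equal _ _)   = no (λ ())
IsOpen? (open' _ _ _) = yes tt
IsOpen? above         = no (λ ())

IsOpen⇒IsBounded : ∀ {b} (I : Interval b) → IsOpen I → IsBounded I
IsOpen⇒IsBounded (open' _ _ _) _ = tt

-- Clocks above their bound get their value later; their point here is junk.
pointIn : ∀ {b} → Interval b → ℚ → ℚ
pointIn (equal c _)   _ = ℤtoℚ (+ c)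
pointIn (open' c _ _) t = ℤtoℚ (+ c ℤ.- + 1) ℚ.+ t
pointIn above         _ = 0ℚ

offset-bounds : ∀ k {t} → Offset t → ℤtoℚ k ℚ.< ℤtoℚ k ℚ.+ t × ℤtoℚ k ℚ.+ t ℚ.< ℤtoℚ (k ℤ.+ + 1)
offset-bounds k {t} (0<t , t<1) =
  subst (ℚ._< ℤtoℚ k ℚ.+ t) (ℚP.+-identityʳ (ℤtoℚ k)) (ℚP.+-monoʳ-< (ℤtoℚ k) 0<t) ,
  subst (ℤtoℚ k ℚ.+ t ℚ.<_) (sym (ℤtoℚ-+ k (+ 1))) (ℚP.+-monoʳ-< (ℤtoℚ k) t<1)

IsCeilW-add-offset : ∀ k {t} → Offset t → IsCeilW (ℤtoℚ k ℚ.+ t) (fin strict (k ℤ.+ + 1))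
IsCeilW-add-offset k off = fractional (k ℤ.+ + 1)
  (subst (λ z → ℤtoℚ z ℚ.< ℤtoℚ k ℚ.+ _) (sym (i+1-1≡i k)) (proj₁ (offset-bounds k off)))
  (proj₂ (offset-bounds k off))

IsCeilW-sub-offset : ∀ k {t} → Offset t → IsCeilW (ℤtoℚ k ℚ.- t) (fin strict k)
IsCeilW-sub-offset k {t} (0<t , t<1) = fractional k
  (subst (ℚ._< ℤtoℚ k ℚ.- t) (sym (ℤtoℚ-sub k (+ 1))) (ℚP.+-monoʳ-< (ℤtoℚ k) (ℚP.neg-antimono-< t<1)))
  (subst (ℤtoℚ k ℚ.- t ℚ.<_) (ℚP.+-identityʳ (ℤtoℚ k)) (ℚP.+-monoʳ-< (ℤtoℚ k) (ℚP.neg-antimono-< 0<t)))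

IsCeilW-integral-+ : ∀ {p q k w} → IsCeilW p (fin weak k) → IsCeilW q w → IsCeilW (p ℚ.+ q) (fin weak k ⊕ w)
IsCeilW-integral-+ (integral k refl) (integral m refl) = integral (k ℤ.+ m) (sym (ℤtoℚ-+ k m))
IsCeilW-integral-+ {q = q} (integral k refl) (fractional m m-1<q q<m) = fractional (k ℤ.+ m)
  (subst (ℚ._< ℤtoℚ k ℚ.+ q) (trans (sym (ℤtoℚ-+ k (m ℤ.- + 1))) (cong ℤtoℚ (+-assoc-sub k m)))
    (ℚP.+-monoʳ-< (ℤtoℚ k) m-1<q))
  (subst (ℤtoℚ k ℚ.+ q ℚ.<_) (sym (ℤtoℚ-+ k m)) (ℚP.+-monoʳ-< (ℤtoℚ k) q<m))
  where
  +-assoc-sub : ∀ (k m : ℤ) → k ℤ.+ (m ℤ.- + 1) ≡ (k ℤ.+ m) ℤ.- + 1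
  +-assoc-sub = solve-∀

pointIn-InInterval : ∀ {b} (I : Interval b) {t} → IsBounded I → Offset t → InInterval (pointIn I t) I
pointIn-InInterval (equal _ _)   _ _ = refl
pointIn-InInterval (open' c _ _) {t} _ off =
  subst (ℚ._< ℤtoℚ (+ c ℤ.- + 1) ℚ.+ t) (ℤtoℚ-sub (+ c) (+ 1)) (proj₁ (offset-bounds (+ c ℤ.- + 1) off)) ,
  subst (λ k → ℤtoℚ (+ c ℤ.- + 1) ℚ.+ t ℚ.< ℤtoℚ k) (i-1+1≡i (+ c))
    (proj₂ (offset-bounds (+ c ℤ.- + 1) off))

fracPart-pointIn : ∀ {b} (I : Interval b) {t} → IsOpen I → Offset t → ℚ.fracPart (pointIn I t) ≡ t
fracPart-pointIn I@(open' c 1≤c _) {t} _ off =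
  trans (fracPart-InUnit _ c 1≤c (pointIn-InInterval I tt off)) (add-sub-cancel (ℤtoℚ (+ c ℤ.- + 1)) t)
  where
  add-sub-cancel : ∀ (a t : ℚ) → a ℚ.+ t ℚ.- a ≡ t
  add-sub-cancel = QS.solve 2 (λ a t → a QS.:+ t QS.:- a QS.:= t) refl

IsCeilW-pointIn : ∀ {b} (I : Interval b) {t} → IsBounded I → Offset t → IsCeilW (pointIn I t) (upper I)
IsCeilW-pointIn (equal c _)   _ _   = integral (+ c) refl
IsCeilW-pointIn (open' c _ _) {t} _ off =
  subst (IsCeilW (ℤtoℚ (+ c ℤ.- + 1) ℚ.+ t) ∘ fin strict) (i-1+1≡i (+ c)) (IsCeilW-add-offset (+ c ℤ.- + 1) off)

IsCeilW-neg-pointIn : ∀ {b} (I : Interval b) {t} → IsBounded I → Offset t → IsCeilW (ℚ.- pointIn I t) (lower I)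
IsCeilW-neg-pointIn (equal c _) _ _ = integral (ℤ.- + c) (sym (ℤtoℚ-neg (+ c)))
IsCeilW-neg-pointIn (open' (suc c) _ _) {t} _ off =
  subst (λ p → IsCeilW p _) (trans (cong (ℚ._- t) (ℤtoℚ-neg (+ c))) (neg-+ (ℤtoℚ (+ c)) t))
    (IsCeilW-sub-offset (ℤ.- + c) off)
  where
  neg-+ : ∀ (a t : ℚ) → ℚ.- a ℚ.- t ≡ ℚ.- (a ℚ.+ t)
  neg-+ = QS.solve 2 (λ a t → QS.:- a QS.:- t QS.:= QS.:- (a QS.:+ t)) refl

IsCeilW-pointIn-via-x₀ : ∀ {b b′} (I : Interval b) (J : Interval b′) {t t′} → IsBounded I → IsBounded J
  → ¬ IsOpen I ⊎ ¬ IsOpen J → Offset t → Offset t′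
  → IsCeilW (pointIn J t′ ℚ.- pointIn I t) (lower I ⊕ upper J)
IsCeilW-pointIn-via-x₀ I@(equal _ _) J {t} {t′} _ bJ _ off off′ =
  subst (λ p → IsCeilW p _) (ℚP.+-comm (ℚ.- pointIn I t) (pointIn J t′))
    (IsCeilW-integral-+ (IsCeilW-neg-pointIn I tt off) (IsCeilW-pointIn J bJ off′))
IsCeilW-pointIn-via-x₀ I@(open' _ _ _) J@(equal d _) _ _ _ off off′ =
  subst (IsCeilW _) (⊕-comm (fin weak (+ d)) (lower I))
    (IsCeilW-integral-+ (IsCeilW-pointIn J tt off′) (IsCeilW-neg-pointIn I tt off))
IsCeilW-pointIn-via-x₀ (open' _ _ _) (open' _ _ _) _ _ (inj₁ ¬open) _ _ = ⊥-elim (¬open tt)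
IsCeilW-pointIn-via-x₀ (open' _ _ _) (open' _ _ _) _ _ (inj₂ ¬open) _ _ = ⊥-elim (¬open tt)

openEnd : ∀ {b} → Interval b → ℤ
openEnd (open' c _ _) = + c
openEnd _             = + 0

Offset-sub : ∀ {t t′} → Offset t → Offset t′ → t ℚ.< t′ → Offset (t′ ℚ.- t)
Offset-sub {t} {t′} (0<t , _) (_ , t′<1) t<t′ = p<q⇒0<q-p t<t′ ,
  ℚP.<-trans (subst (t′ ℚ.- t ℚ.<_) (ℚP.+-identityʳ t′) (ℚP.+-monoʳ-< t′ (ℚP.neg-antimono-< 0<t))) t′<1

pointIn-open-sub : ∀ {b b′} (I : Interval b) (J : Interval b′) t t′ → IsOpen I → IsOpen J
  → pointIn J t′ ℚ.- pointIn I t ≡ ℤtoℚ (openEnd J ℤ.- openEnd I) ℚ.+ (t′ ℚ.- t)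
pointIn-open-sub (open' c _ _) (open' d _ _) t t′ _ _ = begin
  (ℤtoℚ (+ d ℤ.- + 1) ℚ.+ t′) ℚ.- (ℤtoℚ (+ c ℤ.- + 1) ℚ.+ t)
    ≡⟨ regroup (ℤtoℚ (+ d ℤ.- + 1)) (ℤtoℚ (+ c ℤ.- + 1)) t t′ ⟩
  (ℤtoℚ (+ d ℤ.- + 1) ℚ.- ℤtoℚ (+ c ℤ.- + 1)) ℚ.+ (t′ ℚ.- t)
    ≡⟨ cong (ℚ._+ (t′ ℚ.- t)) (sym (ℤtoℚ-sub (+ d ℤ.- + 1) (+ c ℤ.- + 1))) ⟩
  ℤtoℚ ((+ d ℤ.- + 1) ℤ.- (+ c ℤ.- + 1)) ℚ.+ (t′ ℚ.- t)
    ≡⟨ cong (λ k → ℤtoℚ k ℚ.+ (t′ ℚ.- t)) ([j-1]-[i-1]≡j-i (+ c) (+ d)) ⟩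
  ℤtoℚ (+ d ℤ.- + c) ℚ.+ (t′ ℚ.- t) ∎
  where
  open ≡-Reasoning
  regroup : ∀ (a b t t′ : ℚ) → (a ℚ.+ t′) ℚ.- (b ℚ.+ t) ≡ (a ℚ.- b) ℚ.+ (t′ ℚ.- t)
  regroup = QS.solve 4 (λ a b t t′ → (a QS.:+ t′) QS.:- (b QS.:+ t) QS.:= (a QS.:- b) QS.:+ (t′ QS.:- t)) refl

module _ {b b′} (I : Interval b) (J : Interval b′) {t t′} (openI : IsOpen I) (openJ : IsOpen J)
         (off : Offset t) (off′ : Offset t′) where

  private
    k : ℤ
    k = openEnd J ℤ.- openEnd I
    decomposition : pointIn J t′ ℚ.- pointIn I t ≡ ℤtoℚ k ℚ.+ (t′ ℚ.- t)
    decomposition = pointIn-open-sub I J t t′ openI openJ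

  IsCeilW-pointIn-< : t ℚ.< t′ → IsCeilW (pointIn J t′ ℚ.- pointIn I t) (lower I ⊕ upper J)
  IsCeilW-pointIn-< t<t′ = subst₂ IsCeilW (sym decomposition) (lower⊕upper I J openI openJ)
    (IsCeilW-add-offset k (Offset-sub off off′ t<t′))
    where
    lower⊕upper : ∀ {b b′} (I : Interval b) (J : Interval b′) → IsOpen I → IsOpen J
      → fin strict (openEnd J ℤ.- openEnd I ℤ.+ + 1) ≡ lower I ⊕ upper J
    lower⊕upper (open' (suc c) _ _) (open' d _ _) _ _ = cong (fin strict) (rearrange (+ c) (+ d))
      where
      rearrange : ∀ (c d : ℤ) → d ℤ.- (+ 1 ℤ.+ c) ℤ.+ + 1 ≡ ℤ.- c ℤ.+ d
      rearrange = solve-∀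

  IsCeilW-pointIn-≡ : t ≡ t′ → IsCeilW (pointIn J t′ ℚ.- pointIn I t) (fin weak k)
  IsCeilW-pointIn-≡ refl = integral k (trans decomposition
    (trans (cong (ℤtoℚ k ℚ.+_) (ℚP.+-inverseʳ t)) (ℚP.+-identityʳ (ℤtoℚ k))))

  IsCeilW-pointIn-> : t′ ℚ.< t → IsCeilW (pointIn J t′ ℚ.- pointIn I t) (fin strict k)
  IsCeilW-pointIn-> t′<t = subst (λ p → IsCeilW p (fin strict k))
    (sym (trans decomposition (cong (ℤtoℚ k ℚ.+_) (sym (neg-sub t t′)))))
    (IsCeilW-sub-offset k (Offset-sub off′ off t′<t))

fromXY-eq : ∀ {b b′} (I : Interval b) (J : Interval b′) → IsOpen I → IsOpen J
  → fromXY I J eq ≡ fin weak (openEnd J ℤ.- openEnd I)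
fromXY-eq (open' _ _ _) (open' _ _ _) _ _ = refl

fromXY-gt : ∀ {b b′} (I : Interval b) (J : Interval b′) → IsOpen I → IsOpen J
  → fromXY I J gt ≡ fin strict (openEnd J ℤ.- openEnd I)
fromXY-gt (open' _ _ _) (open' _ _ _) _ _ = refl

fromYX-eq : ∀ {b b′} (J : Interval b′) (I : Interval b) → IsOpen J → IsOpen I
  → fromYX J I eq ≡ fin weak (openEnd J ℤ.- openEnd I)
fromYX-eq (open' _ _ _) (open' _ _ _) _ _ = refl

fromYX-lt : ∀ {b b′} (J : Interval b′) (I : Interval b) → IsOpen J → IsOpen I
  → fromYX J I lt ≡ fin strict (openEnd J ℤ.- openEnd I)
fromYX-lt (open' _ _ _) (open' _ _ _) _ _ = refl

InInterval-nonneg : ∀ {b} (I : Interval b) q → InInterval q I → 0ℚ ℚ.≤ q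
InInterval-nonneg (equal c _) _ refl = 0≤ℤtoℚ+ c
InInterval-nonneg (open' (suc c) _ _) q (c<q , _) =
  ℚP.<⇒≤ (ℚP.≤-<-trans (0≤ℤtoℚ+ c) (subst (ℚ._< q) (sym (ℤtoℚ-sub (+ suc c) (+ 1))) c<q))
InInterval-nonneg {b} above q b<q = ℚP.<⇒≤ (ℚP.≤-<-trans (0≤ℤtoℚ+ b) b<q)

SatW-lower⇒InInterval : ∀ {b} (I : Interval b) q → ¬ IsBounded I → SatW (0ℚ ℚ.- q) (lower I) → InInterval q I
SatW-lower⇒InInterval (equal _ _)   _ unbounded _ = ⊥-elim (unbounded tt)
SatW-lower⇒InInterval (open' _ _ _) _ unbounded _ = ⊥-elim (unbounded tt)
SatW-lower⇒InInterval {b} above q _ -q<-b = subst₂ ℚ._<_ (neg-involutive (ℤtoℚ (+ b))) (neg-involutive q)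
  (ℚP.neg-antimono-< (subst₂ ℚ._<_ (ℚP.+-identityˡ (ℚ.- q)) (ℤtoℚ-neg (+ b)) -q<-b))

_≟ᶠ_ : (a b : FracCmp) → Dec (a ≡ b)
lt ≟ᶠ lt = yes refl
lt ≟ᶠ eq = no (λ ())
lt ≟ᶠ gt = no (λ ())
eq ≟ᶠ lt = no (λ ())
eq ≟ᶠ eq = yes refl
eq ≟ᶠ gt = no (λ ())
gt ≟ᶠ lt = no (λ ())
gt ≟ᶠ eq = no (λ ())
gt ≟ᶠ gt = yes refl

SatFrac-via : ∀ {p q s t} k → ℚ.fracPart p ≡ s → ℚ.fracPart q ≡ t
  → (k ≡ lt → s ℚ.< t) → (k ≡ eq → s ≡ t) → (k ≡ gt → t ℚ.< s) → SatFrac p q k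
SatFrac-via lt refl refl s<t _   _   = s<t refl
SatFrac-via eq refl refl _   s≡t _   = s≡t refl
SatFrac-via gt refl refl _   _   t<s = t<s refl

module Construction {n : ℕ} {α : Fin n → ℕ} (R : Region α) {G Zc Rc : Graph n}
  (canonicalR : IsCanonicalFormOf (regionGraph R) Rc) (canonicalZ : IsCanonicalFormOf G Zc)
  (nonneg : ∀ x y → 0w ≤w Zc y x ⊕ Rc x y) where

  module CR = Canonical canonicalR
  module CZ = Canonical canonicalZ

  iv : (x : Fin n) → Interval (α x)
  iv = interval R

  0≤closed-walk : ∀ x (p : Walk x x) → 0w ≤w walkWeight (regionGraph R) p
  0≤closed-walk x p = ≤w-trans (nonneg x x)
    (≤w-trans (⊕-mono-≤w (CZ.diagonal≤0 x) (CR.≤-walk x x p)) (≤w-reflexive (⊕-identityˡ _)))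

  0≤Zc-diagonal : ∀ x → 0w ≤w Zc x x
  0≤Zc-diagonal x = ≤w-trans (nonneg x x)
    (≤w-trans (⊕-monoʳ-≤w (Zc x x) (CR.diagonal≤0 x)) (≤w-reflexive (⊕-identityʳ _)))

  Open : Fin n → Set
  Open x = IsOpen (iv x)

  end : Fin n → ℤ
  end x = openEnd (iv x)

  -- frac x < frac y, as recorded by R in either orientation
  _≺_ : Fin n → Fin n → Set
  x ≺ y = frac R y x ≡ gt ⊎ frac R x y ≡ lt

  _≈_ : Fin n → Fin n → Set
  x ≈ y = frac R x y ≡ eq ⊎ frac R y x ≡ eq

  ≈-sym : ∀ {x y} → x ≈ y → y ≈ x
  ≈-sym (inj₁ e) = inj₂ e
  ≈-sym (inj₂ e) = inj₁ e

  regionGraph-clocks : ∀ x y → x ≢ y → regionGraph R (suc x) (suc y)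
    ≡ fromXY (iv x) (iv y) (frac R x y) ⊓w fromYX (iv y) (iv x) (frac R y x)
  regionGraph-clocks x y x≢y with x Fin.≟ y
  ... | yes x≡y = ⊥-elim (x≢y x≡y)
  ... | no _    = refl

  ≺⇒edge : ∀ {x y} → x ≢ y → Open x → Open y → y ≺ x
    → regionGraph R (suc x) (suc y) ≤w fin strict (end y ℤ.- end x)
  ≺⇒edge {x} {y} x≢y ox oy (inj₁ e) rewrite regionGraph-clocks x y x≢y = ≤w-trans
    (⊓w-≤ˡ (fromXY (iv x) (iv y) (frac R x y)) _)
    (≤w-reflexive (trans (cong (fromXY (iv x) (iv y)) e) (fromXY-gt (iv x) (iv y) ox oy)))
  ≺⇒edge {x} {y} x≢y ox oy (inj₂ e) rewrite regionGraph-clocks x y x≢y = ≤w-trans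
    (⊓w-≤ʳ (fromXY (iv x) (iv y) (frac R x y)) _)
    (≤w-reflexive (trans (cong (fromYX (iv y) (iv x)) e) (fromYX-lt (iv y) (iv x) oy ox)))

  ≈⇒edge : ∀ {x y} → x ≢ y → Open x → Open y → x ≈ y
    → regionGraph R (suc x) (suc y) ≤w fin weak (end y ℤ.- end x)
  ≈⇒edge {x} {y} x≢y ox oy (inj₁ e) rewrite regionGraph-clocks x y x≢y = ≤w-trans
    (⊓w-≤ˡ (fromXY (iv x) (iv y) (frac R x y)) _)
    (≤w-reflexive (trans (cong (fromXY (iv x) (iv y)) e) (fromXY-eq (iv x) (iv y) ox oy)))
  ≈⇒edge {x} {y} x≢y ox oy (inj₂ e) rewrite regionGraph-clocks x y x≢y = ≤w-trans
    (⊓w-≤ʳ (fromXY (iv x) (iv y) (frac R x y)) _)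
    (≤w-reflexive (trans (cong (fromYX (iv y) (iv x)) e) (fromYX-eq (iv y) (iv x) oy ox)))

  -- The ends telescope around the cycle, so a single strict edge makes it negative.
  no-strict-2-cycle : ∀ x y s₁ s₂
    → regionGraph R (suc x) (suc y) ≤w fin s₁ (end y ℤ.- end x)
    → regionGraph R (suc y) (suc x) ≤w fin s₂ (end x ℤ.- end y)
    → s₁ ⊕s (s₂ ⊕s weak) ≡ strict → ⊥
  no-strict-2-cycle x y s₁ s₂ xy yx strict-sum = nonnegative⇒¬negative
    (0≤closed-walk (suc x) (suc y ∷ suc x ∷ []))
    (≤w-trans (⊕-mono-≤w xy (⊕-monoˡ-≤w 0w yx)) (≤w-reflexive (cong₂ fin strict-sum (telescope (end x) (end y)))))
    where
    telescope : ∀ (a b : ℤ) → (b ℤ.- a) ℤ.+ ((a ℤ.- b) ℤ.+ + 0) ≡ + 0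
    telescope = solve-∀

  no-strict-3-cycle : ∀ x y z s₁ s₂ s₃
    → regionGraph R (suc x) (suc y) ≤w fin s₁ (end y ℤ.- end x)
    → regionGraph R (suc y) (suc z) ≤w fin s₂ (end z ℤ.- end y)
    → regionGraph R (suc z) (suc x) ≤w fin s₃ (end x ℤ.- end z)
    → s₁ ⊕s (s₂ ⊕s (s₃ ⊕s weak)) ≡ strict → ⊥
  no-strict-3-cycle x y z s₁ s₂ s₃ xy yz zx strict-sum = nonnegative⇒¬negative
    (0≤closed-walk (suc x) (suc y ∷ suc z ∷ suc x ∷ []))
    (≤w-trans (⊕-mono-≤w xy (⊕-mono-≤w yz (⊕-monoˡ-≤w 0w zx)))
      (≤w-reflexive (cong₂ fin strict-sum (telescope (end x) (end y) (end z)))))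
    where
    telescope : ∀ (a b c : ℤ) → (b ℤ.- a) ℤ.+ ((c ℤ.- b) ℤ.+ ((a ℤ.- c) ℤ.+ + 0)) ≡ + 0
    telescope = solve-∀

  ≺-asym : ∀ {x y} → Open x → Open y → x ≢ y → x ≺ y → y ≺ x → ⊥
  ≺-asym {x} {y} ox oy x≢y x≺y y≺x =
    no-strict-2-cycle x y strict strict (≺⇒edge x≢y ox oy y≺x) (≺⇒edge (x≢y ∘ sym) oy ox x≺y) refl

  ≺⇒≉ : ∀ {x y} → Open x → Open y → x ≢ y → x ≺ y → x ≈ y → ⊥
  ≺⇒≉ {x} {y} ox oy x≢y x≺y x≈y =
    no-strict-2-cycle x y weak strict (≈⇒edge x≢y ox oy x≈y) (≺⇒edge (x≢y ∘ sym) oy ox x≺y) refl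

  ≺-trans : ∀ {z x y} → Open z → Open x → Open y → z ≢ x → x ≢ y → z ≢ y → z ≺ x → x ≺ y → z ≺ y
  ≺-trans {z} {x} {y} oz ox oy z≢x x≢y z≢y z≺x x≺y with frac R z y in e
  ... | lt = inj₂ refl
  ... | eq = ⊥-elim (no-strict-3-cycle y x z strict strict weak
    (≺⇒edge (x≢y ∘ sym) oy ox x≺y) (≺⇒edge (z≢x ∘ sym) ox oz z≺x) (≈⇒edge z≢y oz oy (inj₁ e)) refl)
  ... | gt = ⊥-elim (no-strict-3-cycle y x z strict strict strict
    (≺⇒edge (x≢y ∘ sym) oy ox x≺y) (≺⇒edge (z≢x ∘ sym) ox oz z≺x) (≺⇒edge z≢y oz oy (inj₁ e)) refl)

  ≺-≈-trans : ∀ {z x y} → Open z → Open x → Open y → z ≢ x → x ≢ y → z ≢ y → z ≺ x → x ≈ y → z ≺ y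
  ≺-≈-trans {z} {x} {y} oz ox oy z≢x x≢y z≢y z≺x x≈y with frac R z y in e
  ... | lt = inj₂ refl
  ... | eq = ⊥-elim (no-strict-3-cycle y x z weak strict weak
    (≈⇒edge (x≢y ∘ sym) oy ox (≈-sym x≈y)) (≺⇒edge (z≢x ∘ sym) ox oz z≺x) (≈⇒edge z≢y oz oy (inj₁ e)) refl)
  ... | gt = ⊥-elim (no-strict-3-cycle y x z weak strict strict
    (≈⇒edge (x≢y ∘ sym) oy ox (≈-sym x≈y)) (≺⇒edge (z≢x ∘ sym) ox oz z≺x) (≺⇒edge z≢y oz oy (inj₁ e)) refl)

  Below : Fin n → Fin n → Set
  Below x z = Open z × z ≢ x × z ≺ x

  Below? : ∀ x z → Dec (Below x z)
  Below? x z = IsOpen? (iv z) Dec.×-dec (Dec.¬? (z Fin.≟ x) Dec.×-dec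
    ((frac R x z ≟ᶠ gt) Dec.⊎-dec (frac R z x ≟ᶠ lt)))

  rank : Fin n → ℕ
  rank x = count (Below? x)

  rank-< : ∀ {x y} → Open x → Open y → x ≢ y → x ≺ y → rank x ℕ.< rank y
  rank-< {x} {y} ox oy x≢y x≺y =
    count-strictMono (Below? x) (Below? y) below-y x (ox , x≢y , x≺y) (λ (_ , x≢x , _) → x≢x refl)
    where
    below-y : ∀ z → Below x z → Below y z
    below-y z (oz , z≢x , z≺x) = oz , z≢y , ≺-trans oz ox oy z≢x x≢y z≢y z≺x x≺y
      where
      z≢y : z ≢ y
      z≢y refl = ≺-asym ox oy x≢y x≺y z≺x

  rank-≡ : ∀ {x y} → Open x → Open y → x ≢ y → x ≈ y → rank x ≡ rank y
  rank-≡ {x} {y} ox oy x≢y x≈y =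
    count-cong (Below? x) (Below? y) (below ox oy x≢y x≈y) (below oy ox (x≢y ∘ sym) (≈-sym x≈y))
    where
    below : ∀ {x y} → Open x → Open y → x ≢ y → x ≈ y → ∀ z → Below x z → Below y z
    below {x} {y} ox oy x≢y x≈y z (oz , z≢x , z≺x) = oz , z≢y , ≺-≈-trans oz ox oy z≢x x≢y z≢y z≺x x≈y
      where
      z≢y : z ≢ y
      z≢y refl = ≺⇒≉ oy ox (x≢y ∘ sym) z≺x (≈-sym x≈y)

  offset : Fin n → ℚ
  offset x = fraction n (rank x)

  offset-Offset : ∀ x → Offset (offset x)
  offset-Offset x = fraction-offset n (rank x) (count≤n (Below? x))

  Bounded : Fin n → Set
  Bounded x = IsBounded (iv x)

  point : Valuation n
  point x = pointIn (iv x) (offset x)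

  point-InInterval : ∀ x → Bounded x → InInterval (point x) (iv x)
  point-InInterval x bx = pointIn-InInterval (iv x) bx (offset-Offset x)

  point-fracPart : ∀ x → Open x → ℚ.fracPart (point x) ≡ offset x
  point-fracPart x ox = fracPart-pointIn (iv x) ox (offset-Offset x)

  point-SatFrac : ∀ x y → x ≢ y → Open x → Open y → SatFrac (point x) (point y) (frac R x y)
  point-SatFrac x y x≢y ox oy = SatFrac-via (frac R x y) (point-fracPart x ox) (point-fracPart y oy)
    (λ e → fraction-mono n (rank-< ox oy x≢y (inj₂ e)))
    (λ e → cong (fraction n) (rank-≡ ox oy x≢y (inj₁ e)))
    (λ e → fraction-mono n (rank-< oy ox (x≢y ∘ sym) (inj₁ e)))

  Rc-via-x₀ : ∀ x y → Rc (suc x) (suc y) ≤w lower (iv x) ⊕ upper (iv y)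
  Rc-via-x₀ x y = ≤w-trans (CR.triangle (suc x) zero (suc y))
    (⊕-mono-≤w (CR.≤-edge (suc x) zero) (CR.≤-edge zero (suc y)))

  -- Between bounded vertices, Rc is attained at the point up to rounding.
  Tight : Vertex n → Vertex n → Set
  Tight s t = Σ Weight (λ w → IsCeilW (ext point t ℚ.- ext point s) w × Rc s t ≤w w)

  tight-via-x₀ : ∀ x y → Bounded x → Bounded y → ¬ Open x ⊎ ¬ Open y → Tight (suc x) (suc y)
  tight-via-x₀ x y bx by not-open = lower (iv x) ⊕ upper (iv y) ,
    IsCeilW-pointIn-via-x₀ (iv x) (iv y) bx by not-open (offset-Offset x) (offset-Offset y) ,
    Rc-via-x₀ x y

  tight-open : ∀ x y → x ≢ y → Open x → Open y → Tight (suc x) (suc y)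
  tight-open x y x≢y ox oy = by-comparison (frac R x y) refl
    where
    by-comparison : ∀ k → frac R x y ≡ k → Tight (suc x) (suc y)
    by-comparison lt e = lower (iv x) ⊕ upper (iv y) ,
      IsCeilW-pointIn-< (iv x) (iv y) ox oy (offset-Offset x) (offset-Offset y)
        (fraction-mono n (rank-< ox oy x≢y (inj₂ e))) ,
      Rc-via-x₀ x y
    by-comparison eq e = fin weak (end y ℤ.- end x) ,
      IsCeilW-pointIn-≡ (iv x) (iv y) ox oy (offset-Offset x) (offset-Offset y)
        (cong (fraction n) (rank-≡ ox oy x≢y (inj₁ e))) ,
      ≤w-trans (CR.≤-edge (suc x) (suc y)) (≈⇒edge x≢y ox oy (inj₁ e))
    by-comparison gt e = fin strict (end y ℤ.- end x) ,
      IsCeilW-pointIn-> (iv x) (iv y) ox oy (offset-Offset x) (offset-Offset y)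
        (fraction-mono n (rank-< oy ox (x≢y ∘ sym) (inj₁ e))) ,
      ≤w-trans (CR.≤-edge (suc x) (suc y)) (≺⇒edge x≢y ox oy (inj₁ e))

  tight-clocks : ∀ x y → x ≢ y → Bounded x → Bounded y → Dec (Open x) → Dec (Open y) → Tight (suc x) (suc y)
  tight-clocks x y x≢y _  _  (yes ox) (yes oy) = tight-open x y x≢y ox oy
  tight-clocks x y _   bx by (no ¬ox) _        = tight-via-x₀ x y bx by (inj₁ ¬ox)
  tight-clocks x y _   bx by (yes _)  (no ¬oy) = tight-via-x₀ x y bx by (inj₂ ¬oy)

  tight-distinct : ∀ s t → WithZero Bounded s → WithZero Bounded t → s ≢ t → Tight s t
  tight-distinct zero    zero    _  _  s≢t = ⊥-elim (s≢t refl)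
  tight-distinct zero    (suc y) _  by _   = upper (iv y) ,
    subst (λ p → IsCeilW p (upper (iv y))) (sym (p-0≡p (point y))) (IsCeilW-pointIn (iv y) by (offset-Offset y)) ,
    CR.≤-edge zero (suc y)
  tight-distinct (suc x) zero    bx _  _   = lower (iv x) ,
    subst (λ p → IsCeilW p (lower (iv x))) (sym (0-p≡-p (point x))) (IsCeilW-neg-pointIn (iv x) bx (offset-Offset x)) ,
    CR.≤-edge (suc x) zero
  tight-distinct (suc x) (suc y) bx by s≢t =
    tight-clocks x y (s≢t ∘ cong suc) bx by (IsOpen? (iv x)) (IsOpen? (iv y))

  tight : ∀ s t → WithZero Bounded s → WithZero Bounded t → Tight s t
  tight s t bs bt = by-equality (s Fin.≟ t)
    where
    by-equality : Dec (s ≡ t) → Tight s t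
    by-equality (yes refl) = 0w , integral (+ 0) (ℚP.+-inverseʳ (ext point s)) , CR.diagonal≤0 s
    by-equality (no s≢t)   = tight-distinct s t bs bt s≢t

  tight-sat : ∀ s t z → Tight t s → 0w ≤w z ⊕ Rc t s → SatW (ext point t ℚ.- ext point s) z
  tight-sat s t z (w , ceil , Rc≤w) 0≤z⊕Rc = subst (λ q → SatW q z) (neg-sub (ext point s) (ext point t))
    (IsCeilW-tight ceil (≤w-trans 0≤z⊕Rc (⊕-monoʳ-≤w z Rc≤w)))

  point-sat-Zc : ∀ s t → WithZero Bounded s → WithZero Bounded t → SatW (ext point t ℚ.- ext point s) (Zc s t)
  point-sat-Zc s t bs bt = tight-sat s t (Zc s t) (tight t s bt bs) (nonneg t s)

  point-sat-Zc-lower : ∀ x u → WithZero Bounded x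
    → SatW (0ℚ ℚ.- ext point x) (Zc x (suc u) ⊕ lower (iv u))
  point-sat-Zc-lower x u bx = tight-sat x zero (Zc x (suc u) ⊕ lower (iv u)) (tight zero x tt bx)
    (≤w-trans (nonneg (suc u) x) (≤w-trans (⊕-monoʳ-≤w (Zc x (suc u)) Rc-via-x₀′)
      (≤w-reflexive (sym (⊕-assoc (Zc x (suc u)) (lower (iv u)) (Rc zero x))))))
    where
    Rc-via-x₀′ : Rc (suc u) x ≤w lower (iv u) ⊕ Rc zero x
    Rc-via-x₀′ = ≤w-trans (CR.triangle (suc u) zero x) (⊕-monoˡ-≤w (Rc zero x) (CR.≤-edge (suc u) zero))

  throughLower : Vertex n → Weight
  throughLower x = minOver (λ u → Zc x (suc u) ⊕ lower (iv u))

  -- Zc with its edges into x₀ strengthened, so that clocks above their bound end up above it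
  Z′ : Graph n
  Z′ x zero    = Zc x zero ⊓w throughLower x
  Z′ x (suc y) = Zc x (suc y)

  Z′≤Zc : ∀ x y → Z′ x y ≤w Zc x y
  Z′≤Zc x zero    = ⊓w-≤ˡ (Zc x zero) (throughLower x)
  Z′≤Zc x (suc y) = ≤w-refl

  Z′-lower : ∀ x → Z′ (suc x) zero ≤w lower (iv x)
  Z′-lower x = ≤w-trans (⊓w-≤ʳ (Zc (suc x) zero) _) (≤w-trans (minOver-≤ _ x)
    (≤w-trans (⊕-monoˡ-≤w (lower (iv x)) (CZ.diagonal≤0 (suc x))) (≤w-reflexive (⊕-identityˡ (lower (iv x))))))

  Z′-diagonal : ∀ k → SatW 0ℚ (Z′ (suc k) (suc k))
  Z′-diagonal k = SatW-mono {a = 0w} ℚP.≤-refl (0≤Zc-diagonal (suc k))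

  Z′-triangle : ∀ x y k → Z′ x y ≤w Z′ x (suc k) ⊕ Z′ (suc k) y
  Z′-triangle x (suc y) k = CZ.triangle x (suc k) (suc y)
  Z′-triangle x zero k with ⊓w-sel (Zc (suc k) zero) (throughLower (suc k))
  ... | inj₁ e rewrite e = ≤w-trans (⊓w-≤ˡ (Zc x zero) _) (CZ.triangle x (suc k) zero)
  ... | inj₂ e rewrite e with minOver-attained (λ u → Zc (suc k) (suc u) ⊕ lower (iv u))
  ...   | inj₁ e′ rewrite e′ | ⊕-zeroʳ (Zc x (suc k)) = ≤w-∞
  ...   | inj₂ (u , e′) rewrite e′ = ≤w-trans (⊓w-≤ʳ (Zc x zero) _) (≤w-trans (minOver-≤ _ u)
    (≤w-trans (⊕-monoˡ-≤w (lower (iv u)) (CZ.triangle x (suc k) (suc u)))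
      (≤w-reflexive (⊕-assoc (Zc x (suc k)) (Zc (suc k) (suc u)) (lower (iv u))))))

  open Extension Z′ Z′-triangle Z′-diagonal

  point-SatOn : SatOn Bounded point
  point-SatOn x (suc y) bx by = point-sat-Zc x (suc y) bx by
  point-SatOn x zero    bx _  =
    SatW-⊓w (point-sat-Zc x zero bx tt) (minOver-sat _ (λ u → point-sat-Zc-lower x u bx))

  extension : Σ (Valuation n) (λ v → (∀ x y → SatW (ext v y ℚ.- ext v x) (Z′ x y)) × Extends Bounded point v)
  extension = extend-to-all Bounded (IsBounded? ∘ iv) point point-SatOn

  solution : Valuation n
  solution = proj₁ extension

  solution-sat : ∀ x y → SatW (ext solution y ℚ.- ext solution x) (Z′ x y)
  solution-sat = proj₁ (proj₂ extension)

  solution-extends : Extends Bounded point solution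
  solution-extends = proj₂ (proj₂ extension)

  solution-InInterval : ∀ x → InInterval (solution x) (iv x)
  solution-InInterval x = by-boundedness (IsBounded? (iv x))
    where
    by-boundedness : Dec (Bounded x) → InInterval (solution x) (iv x)
    by-boundedness (yes bx) =
      subst (λ q → InInterval q (iv x)) (sym (solution-extends x bx)) (point-InInterval x bx)
    by-boundedness (no ¬bx) = SatW-lower⇒InInterval (iv x) (solution x) ¬bx
      (SatW-mono (solution-sat (suc x) zero) (Z′-lower x))

  solution-∈R : solution ∈R R
  solution-∈R = (λ x → InInterval-nonneg (iv x) (solution x) (solution-InInterval x)) , solution-InInterval ,
    λ x y x≢y ox oy → subst₂ (λ p q → SatFrac p q (frac R x y))
      (sym (solution-extends x (IsOpen⇒IsBounded (iv x) ox)))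
      (sym (solution-extends y (IsOpen⇒IsBounded (iv y) oy)))
      (point-SatFrac x y x≢y ox oy)

  solution-∈G : solution ∈G G
  solution-∈G = proj₁ solution-∈R ,
    λ x y → SatW-mono (solution-sat x y) (≤w-trans (Z′≤Zc x y) (CZ.≤-edge x y))

proposition2 : (n : ℕ) (α : Fin n → ℕ) (R : Region α) (G Zc Rc : Graph n)
    → IsCanonicalFormOf (regionGraph R) Rc
    → IsCanonicalFormOf G Zc
    → ((∀ v → ¬ (v ∈R R × v ∈G G))
       ⇔ ∃₂ (λ (x y : Vertex n) → Zc y x ⊕ Rc x y ≤w fin strict (+ 0)))
proposition2 n α R G Zc Rc canonicalR canonicalZ = mk⇔ negative-cycle disjoint
  where
  negative-cycle : (∀ v → ¬ (v ∈R R × v ∈G G)) → ∃₂ (λ x y → Zc y x ⊕ Rc x y ≤w fin strict (+ 0))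
  negative-cycle empty with FinP.any? (λ x → FinP.any? (λ y → Zc y x ⊕ Rc x y ≤w? fin strict (+ 0)))
  ... | yes found = found
  ... | no none = ⊥-elim (empty solution (solution-∈R , solution-∈G))
    where
    nonneg : ∀ x y → 0w ≤w Zc y x ⊕ Rc x y
    nonneg x y = ¬negative⇒nonnegative (λ negative → none (x , y , negative))
    open Construction R canonicalR canonicalZ nonneg
  disjoint : ∃₂ (λ x y → Zc y x ⊕ Rc x y ≤w fin strict (+ 0)) → ∀ v → ¬ (v ∈R R × v ∈G G)
  disjoint (x , y , negative) v (v∈R , v∈G) = nonnegative⇒¬negative
    (common-solution⇒0≤cycle canonicalZ canonicalR v (proj₂ v∈G) (regionGraph-sat R v v∈R) x y) negative
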